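{- Let $\mathbb{k}$ be a field of characteristic zero, $A$ a commutative unital $\mathbb{k}$-algebra and $B$ a commutative unital $\mathbb{k}$-algebra which is an integral domain. If a $\mathbb{k}$-linear map $f : A \to B$ satisfies $\Phi_{n+1}(f) \equiv 0$ and $f(1) = k\cdot 1_B$ with $k \le n$ a nonnegative integer, then $f$ is a Frobenius $k$-homomorphism.
   Context: For a $\mathbb{k}$-linear map $f : A \to B$ and $m \ge 1$, define $\Phi_m(f)(a_1,\dots,a_m) = \sum_{\sigma \in \Sigma_m} \epsilon(\sigma) f_\sigma(a_1,\dots,a_m)$, where $\epsilon(\sigma)$ is the sign, and if $\sigma = \gamma_1\cdots\gamma_q$ is the disjoint cycle decomposition (including cycles of length one) then $f_\sigma = \prod_j f_{\gamma_j}$ with $f_\gamma(a_1,\dots,a_m) = f(a_{r_1}\cdots a_{r_j})$ for $\gamma = (r_1\,\dots\,r_j)$. $\Phi_m(f)\equiv 0$ means $\Phi_m(f)$ vanishes identically. $f$ is a Frobenius $k$-homomorphism if $\Phi_{k+1}(f)\equiv 0$ and $f(1) = k\cdot 1_B$. -}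

module Defs where

open import Level using (Level; _⊔_)
open import Algebra.Bundles using (CommutativeRing)
open import Data.Nat as ℕ using (ℕ; zero; suc; _<ᵇ_; _≤ᵇ_)
open import Data.Fin as Fin using (Fin; toℕ)
open import Data.Fin.Properties using () renaming (_≟_ to _≟ᶠ_)
open import Data.Vec.Functional using () renaming (_∷_ to _∷ᶠ_)
open import Data.List using (List; []; _∷_; [_]; map; concatMap; allFin; filterᵇ; foldr; length; upTo)
open import Data.Bool.ListAction using (and; or)
open import Data.Bool using (Bool; true; false; _∨_; not; _∧_; if_then_else_)
open import Relation.Nullary using (¬_)
open import Relation.Nullary.Decidable using (⌊_⌋)
open import Data.Product using (Σ; ∃; _×_)
open import Data.Sum using (_⊎_)

module RingOps {c ℓ : Level} (R : CommutativeRing c ℓ) where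
  open CommutativeRing R

  sumL : List Carrier → Carrier
  sumL = foldr _+_ 0#

  prodL : List Carrier → Carrier
  prodL = foldr _*_ 1#

  nat : ℕ → Carrier
  nat zero    = 0#
  nat (suc n) = 1# + nat n

  negOnePow : ℕ → Carrier
  negOnePow zero    = 1#
  negOnePow (suc n) = - (negOnePow n)

record Field (c ℓ : Level) : Set (Level.suc (c ⊔ ℓ)) where
  field
    commRing : CommutativeRing c ℓ
  open CommutativeRing commRing public
  field
    nontrivial : ¬ (1# ≈ 0#)
    inverse    : ∀ x → ¬ (x ≈ 0#) → Σ Carrier (λ y → x * y ≈ 1#)

CharZero : ∀ {c ℓ} → Field c ℓ → Set ℓ
CharZero K = ∀ n → ¬ (nat (suc n) ≈ 0#)
  where open Field K
        open RingOps commRing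

-- Commutative unital 𝕜-algebras: a commutative ring A together with a
-- unital ring homomorphism ι : 𝕜 → A (scalar action c · a = ι c * a).

record CAlgebra {c ℓ : Level} (K : Field c ℓ) (a ℓa : Level)
       : Set (c ⊔ ℓ ⊔ Level.suc (a ⊔ ℓa)) where
  private module K = Field K
  field
    commRing : CommutativeRing a ℓa
  open CommutativeRing commRing public
  field
    ι      : K.Carrier → Carrier
    ι-cong : ∀ {x y} → x K.≈ y → ι x ≈ ι y
    ι-+    : ∀ x y → ι (x K.+ y) ≈ ι x + ι y
    ι-*    : ∀ x y → ι (x K.* y) ≈ ι x * ι y
    ι-1    : ι K.1# ≈ 1#

  _·_ : K.Carrier → Carrier → Carrier
  x · y = ι x * y

IsIntegralDomain : ∀ {c ℓ b ℓb} {K : Field c ℓ} → CAlgebra K b ℓb → Set (b ⊔ ℓb)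
IsIntegralDomain B =
  ¬ (1# ≈ 0#) × (∀ x y → x * y ≈ 0# → x ≈ 0# ⊎ y ≈ 0#)
  where open CAlgebra B

record IsLinear {c ℓ a ℓa b ℓb} {K : Field c ℓ}
       (A : CAlgebra K a ℓa) (B : CAlgebra K b ℓb)
       (f : CAlgebra.Carrier A → CAlgebra.Carrier B) : Set (c ⊔ a ⊔ ℓa ⊔ ℓb) where
  private
    module A = CAlgebra A
    module B = CAlgebra B
  field
    cong  : ∀ {x y} → x A.≈ y → f x B.≈ f y
    additive : ∀ x y → f (x A.+ y) B.≈ f x B.+ f y
    homogeneous : ∀ (λ' : Field.Carrier K) x → f (λ' A.· x) B.≈ λ' B.· f x

-- The symmetric group Σ_m, enumerated as the list of all bijections
-- Fin m → Fin m (all injective self-maps of the finite set Fin m).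

allFuns : (m n : ℕ) → List (Fin m → Fin n)
allFuns zero    n = [ (λ ()) ]
allFuns (suc m) n = concatMap (λ g → map (λ x → x ∷ᶠ g) (allFin n)) (allFuns m n)

_==ᶠ_ : ∀ {m} → Fin m → Fin m → Bool
i ==ᶠ j = ⌊ i ≟ᶠ j ⌋

isInjectiveᵇ : ∀ {m} → (Fin m → Fin m) → Bool
isInjectiveᵇ {m} σ =
  and (concatMap (λ i → map (λ j → (i ==ᶠ j) ∨ not (σ i ==ᶠ σ j)) (allFin m)) (allFin m))

Perms : (m : ℕ) → List (Fin m → Fin m)
Perms m = filterᵇ isInjectiveᵇ (allFuns m m)

inversions : ∀ {m} → (Fin m → Fin m) → ℕ
inversions {m} σ =
  length (filterᵇ (λ b → b)
    (concatMap (λ i → map (λ j → (toℕ i <ᵇ toℕ j) ∧ (toℕ (σ j) <ᵇ toℕ (σ i))) (allFin m)) (allFin m)))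

iter : ∀ {m} → (Fin m → Fin m) → ℕ → Fin m → Fin m
iter σ zero    i = i
iter σ (suc t) i = σ (iter σ t i)

inCycleᵇ : ∀ {m} → (Fin m → Fin m) → Fin m → Fin m → Bool
inCycleᵇ {m} σ i j = or (map (λ t → iter σ t i ==ᶠ j) (upTo m))

-- i is the least element of its cycle (one representative per cycle,
-- cycles of length one included)
isCycleRepᵇ : ∀ {m} → (Fin m → Fin m) → Fin m → Bool
isCycleRepᵇ {m} σ i = and (map (λ t → toℕ i ≤ᵇ toℕ (iter σ t i)) (upTo m))

module _ {c ℓ a ℓa b ℓb} {K : Field c ℓ}
         (A : CAlgebra K a ℓa) (B : CAlgebra K b ℓb) where
  private
    module A = CAlgebra A
    module B = CAlgebra B
    module RA = RingOps A.commRing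
    module RB = RingOps B.commRing

  fCycle : ∀ {m} → (A.Carrier → B.Carrier) → (Fin m → Fin m) → Fin m
           → (Fin m → A.Carrier) → B.Carrier
  fCycle {m} f σ i as =
    f (RA.prodL (map as (filterᵇ (inCycleᵇ σ i) (allFin m))))

  fPerm : ∀ {m} → (A.Carrier → B.Carrier) → (Fin m → Fin m)
          → (Fin m → A.Carrier) → B.Carrier
  fPerm {m} f σ as =
    RB.prodL (map (λ i → fCycle f σ i as) (filterᵇ (isCycleRepᵇ σ) (allFin m)))

  Φ : (m : ℕ) → (A.Carrier → B.Carrier) → (Fin m → A.Carrier) → B.Carrier
  Φ m f as = RB.sumL (map (λ σ → RB.negOnePow (inversions σ) B.* fPerm f σ as) (Perms m))

  ΦVanishes : ℕ → (A.Carrier → B.Carrier) → Set (a ⊔ ℓb)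
  ΦVanishes m f = ∀ (as : Fin m → A.Carrier) → Φ m f as B.≈ B.0#

  IsFrobeniusHom : ℕ → (A.Carrier → B.Carrier) → Set (a ⊔ ℓb)
  IsFrobeniusHom k f = ΦVanishes (suc k) f × (f A.1# B.≈ RB.nat k)

{-# OPTIONS --safe #-}
module Submission where

-- Every σ ∈ Σₘ₊₁ arises exactly once from some τ ∈ Σₘ (acting on 1, …, m) by fixing the new point 0
-- or by inserting it into a cycle of τ right after one of the m points. In Φₘ₊₁(f)(1, b₁, …, bₘ),
-- fixing 0 keeps the sign and adds the cycle (0), a factor f(1); inserting 0 flips the sign and,
-- since a₀ = 1, leaves f_τ unchanged. Hence
--   Φₘ₊₁(f)(1, b) = (f(1) − m) · Φₘ(f)(b).
-- If f(1) = k < m the factor is −(m − k), invertible in characteristic zero, so Φₘ₊₁(f) ≡ 0 forces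
-- Φₘ(f) ≡ 0, and descending from m = n gives Φₖ₊₁(f) ≡ 0.

open import Defs

open import Level using (Level)
open import Algebra.Bundles using (CommutativeMonoid; CommutativeRing)
open import Data.Bool using (Bool; true; false; not; _∧_; _∨_; if_then_else_)
open import Data.Bool.Properties using (T-≡; ⇔→≡; ¬-not; ∧-assoc; ∧-comm; ∧-zeroʳ; ∧-identityʳ)
open import Data.Bool.ListAction using (and; or)
open import Data.Fin using (Fin; zero; suc; toℕ; punchOut)
open import Data.Fin.Properties using (_≟_; suc-injective; toℕ-injective; toℕ<n; pigeonhole; any?; injective⇒≤; punchOut-injective)
open import Data.List using (List; []; _∷_; _++_; length; map; concatMap; filterᵇ; foldr; allFin; upTo; tabulate)
open import Data.List.Properties using (map-∘; map-cong; map-tabulate)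
open import Data.List.Membership.Propositional using (find; lose)
open import Data.List.Membership.Propositional.Properties using (∈-allFin; ∈-upTo⁺; ∈-upTo⁻)
import Data.List.Relation.Unary.All as All
open import Data.List.Relation.Unary.All.Properties using (all⁺; all⁻)
open import Data.List.Relation.Unary.Any.Properties using (any⁺; any⁻)
open import Data.Nat using (ℕ; zero; suc; _+_; _*_; _∸_; _≤_; _<_; _<ᵇ_; _≤ᵇ_; z≤n; s≤s; s≤s⁻¹)
import Data.Nat.ListAction as ℕᴸ
import Data.Nat.Properties as ℕₚ
import Data.Nat.Solver
import Algebra.Properties.Semiring.Sum
open import Data.Sum using (inj₁; inj₂)
open import Data.Product using (∃-syntax; _×_; _,_; proj₁; proj₂)
import Data.Vec.Functional as Vector
open import Data.Vec.Functional using () renaming (_∷_ to _∷ᶠ_)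
open import Function using (_∘_; _⇔_; mk⇔; Equivalence)
open import Function.Definitions using (Injective)
open import Relation.Binary.PropositionalEquality as ≡ using (_≡_; _≢_; ≢-sym; _≗_; refl; sym; trans; cong; cong₂; subst)
open import Relation.Nullary using (¬_; yes; no; contradiction)
open import Relation.Binary.Definitions using (tri<; tri≈; tri>)

open Equivalence using (to; from)

-- Finite sums

[_] : Bool → ℕ
[ b ] = if b then 1 else 0

module BigOperators {c ℓ} (M : CommutativeMonoid c ℓ) where
  open CommutativeMonoid M renaming (Carrier to C; refl to ≈-refl; sym to ≈-sym; trans to ≈-trans; reflexive to ≈-reflexive)
  open import Algebra.Properties.CommutativeMonoid.Sum M public
    using (sum; sum-syntax; sum-cong-≋; sum-cong-≗; ∑-distrib-+; sum-replicate-zero)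
  open import Algebra.Properties.Monoid.Mult monoid public
    using (×-homo-1; ×-homo-+)
    renaming (_×_ to _times_)
  open import Relation.Binary.Reasoning.Setoid setoid

  private
    variable
      x y : Level
      X : Set x
      Y : Set y

  when : Bool → C → C
  when b v = if b then v else ε

  when-cong : ∀ b {u v} → u ≈ v → when b u ≈ when b v
  when-cong true  u≈v = u≈v
  when-cong false _   = ≈-refl

  sumᴸ : List X → (X → C) → C
  sumᴸ L F = foldr _∙_ ε (map F L)

  sumᴸ-cong : ∀ (L : List X) {F G : X → C} → (∀ a → F a ≈ G a) → sumᴸ L F ≈ sumᴸ L G
  sumᴸ-cong []      F≈G = ≈-refl
  sumᴸ-cong (a ∷ L) F≈G = ∙-cong (F≈G a) (sumᴸ-cong L F≈G)

  sumᴸ-zero : ∀ (L : List X) (F : X → C) → (∀ a → F a ≈ ε) → sumᴸ L F ≈ ε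
  sumᴸ-zero []      F F≈ε = ≈-refl
  sumᴸ-zero (a ∷ L) F F≈ε = ≈-trans (∙-cong (F≈ε a) (sumᴸ-zero L F F≈ε)) (identityˡ ε)

  sumᴸ-distrib : ∀ (L : List X) (F G : X → C) → sumᴸ L (λ a → F a ∙ G a) ≈ sumᴸ L F ∙ sumᴸ L G
  sumᴸ-distrib []      F G = ≈-sym (identityˡ ε)
  sumᴸ-distrib (a ∷ L) F G = begin
    (F a ∙ G a) ∙ sumᴸ L (λ a → F a ∙ G a) ≈⟨ ∙-congˡ (sumᴸ-distrib L F G) ⟩
    (F a ∙ G a) ∙ (sumᴸ L F ∙ sumᴸ L G)    ≈⟨ interchange _ _ _ _ ⟩
    (F a ∙ sumᴸ L F) ∙ (G a ∙ sumᴸ L G)    ∎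
    where open import Algebra.Properties.CommutativeSemigroup commutativeSemigroup using (interchange)

  sumᴸ-++ : ∀ (L L′ : List X) (F : X → C) → sumᴸ (L ++ L′) F ≈ sumᴸ L F ∙ sumᴸ L′ F
  sumᴸ-++ []      L′ F = ≈-sym (identityˡ _)
  sumᴸ-++ (a ∷ L) L′ F = ≈-trans (∙-congˡ (sumᴸ-++ L L′ F)) (≈-sym (assoc _ _ _))

  sumᴸ-filterᵇ : ∀ (L : List X) (p : X → Bool) (F : X → C) →
                 sumᴸ (filterᵇ p L) F ≈ sumᴸ L (λ a → when (p a) (F a))
  sumᴸ-filterᵇ []      p F = ≈-refl
  sumᴸ-filterᵇ (a ∷ L) p F with p a
  ... | true  = ∙-congˡ (sumᴸ-filterᵇ L p F)
  ... | false = ≈-trans (sumᴸ-filterᵇ L p F) (≈-sym (identityˡ _))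

  sumᴸ-map : ∀ (L : List X) (g : X → Y) (F : Y → C) → sumᴸ (map g L) F ≡ sumᴸ L (F ∘ g)
  sumᴸ-map L g F = cong (foldr _∙_ ε) (≡.sym (map-∘ L))

  sumᴸ-concatMap : ∀ (L : List X) (h : X → List Y) (F : Y → C) →
                   sumᴸ (concatMap h L) F ≈ sumᴸ L (λ a → sumᴸ (h a) F)
  sumᴸ-concatMap []      h F = ≈-refl
  sumᴸ-concatMap (a ∷ L) h F = ≈-trans (sumᴸ-++ (h a) (concatMap h L) F) (∙-congˡ (sumᴸ-concatMap L h F))

  sumᴸ-comm : ∀ (L : List X) (L′ : List Y) (F : X → Y → C) →
              sumᴸ L (λ a → sumᴸ L′ (F a)) ≈ sumᴸ L′ (λ b → sumᴸ L (λ a → F a b))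
  sumᴸ-comm []      L′ F = ≈-sym (sumᴸ-zero L′ _ (λ _ → ≈-refl))
  sumᴸ-comm (a ∷ L) L′ F = ≈-trans (∙-congˡ (sumᴸ-comm L L′ F)) (≈-sym (sumᴸ-distrib L′ _ _))

  ∑∑-distrib-+ : ∀ {m n} (F G : Fin m → Fin n → C) →
                 ∑[ i < m ] ∑[ j < n ] (F i j ∙ G i j) ≈ ∑[ i < m ] ∑[ j < n ] F i j ∙ ∑[ i < m ] ∑[ j < n ] G i j
  ∑∑-distrib-+ F G = ≈-trans (sum-cong-≋ (λ i → ∑-distrib-+ (F i) (G i))) (∑-distrib-+ (sum ∘ F) (sum ∘ G))

  sumᴸ-tabulate : ∀ n (g : Fin n → X) (F : X → C) → sumᴸ (tabulate g) F ≡ sum (F ∘ g)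
  sumᴸ-tabulate zero    g F = ≡.refl
  sumᴸ-tabulate (suc n) g F = ≡.cong (F (g zero) ∙_) (sumᴸ-tabulate n (g ∘ suc) F)

  sumᴸ-allFin : ∀ n (F : Fin n → C) → sumᴸ (allFin n) F ≡ sum F
  sumᴸ-allFin n = sumᴸ-tabulate n (λ i → i)

  sum-zero : ∀ n (F : Fin n → C) → (∀ i → F i ≈ ε) → sum F ≈ ε
  sum-zero n F F≈ε = ≈-trans (sum-cong-≋ F≈ε) (sum-replicate-zero n)

  sumᴸ-comm-sum : ∀ (L : List X) n (F : X → Fin n → C) →
                  sumᴸ L (λ a → sum (F a)) ≈ sum (λ i → sumᴸ L (λ a → F a i))
  sumᴸ-comm-sum L n F = begin
    sumᴸ L (λ a → sum (F a))                ≈⟨ sumᴸ-cong L (λ a → ≈-reflexive (≡.sym (sumᴸ-allFin n (F a)))) ⟩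
    sumᴸ L (λ a → sumᴸ (allFin n) (F a))    ≈⟨ sumᴸ-comm L (allFin n) F ⟩
    sumᴸ (allFin n) (λ i → sumᴸ L (λ a → F a i)) ≡⟨ sumᴸ-allFin n _ ⟩
    sum (λ i → sumᴸ L (λ a → F a i))        ∎

  sum-when-unique : ∀ n (p : Fin n → Bool) (F : Fin n → C) (i : Fin n) → p i ≡ true →
                    (∀ j → p j ≡ true → j ≡ i) → sum (λ j → when (p j) (F j)) ≈ F i
  sum-when-unique (suc n) p F i pi unique with p zero in p0
  sum-when-unique (suc n) p F zero    pi unique | true =
    ≈-trans (∙-congˡ (sum-zero n _ off)) (identityʳ _)
    where
    off : ∀ j → when (p (suc j)) (F (suc j)) ≈ ε
    off j with p (suc j) in pj
    ... | true  = contradiction (unique (suc j) pj) λ ()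
    ... | false = ≈-refl
  sum-when-unique (suc n) p F (suc i) pi unique | true with () ← unique zero p0
  sum-when-unique (suc n) p F zero    pi unique | false with () ← ≡.trans (≡.sym pi) p0
  sum-when-unique (suc n) p F (suc i) pi unique | false =
    ≈-trans (identityˡ _) (sum-when-unique n (p ∘ suc) (F ∘ suc) i pi (λ j pj → suc-injective (unique (suc j) pj)))

  when-ε : ∀ b → when b ε ≈ ε
  when-ε true  = ≈-refl
  when-ε false = ≈-refl

  when-split : ∀ p q v → when p v ≈ when (p ∧ q) v ∙ when (p ∧ not q) v
  when-split true  true  v = ≈-sym (identityʳ v)
  when-split true  false v = ≈-sym (identityˡ v)
  when-split false q     v = ≈-sym (identityˡ ε)

  sum-when : ∀ n b (F : Fin n → C) → sum (λ i → when b (F i)) ≈ when b (sum F)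
  sum-when n true  F = ≈-refl
  sum-when n false F = sum-zero n _ (λ _ → ≈-refl)

  sumᴸ-× : ∀ (L : List X) (N : X → ℕ) v → sumᴸ L (λ a → N a times v) ≈ ℕᴸ.sum (map N L) times v
  sumᴸ-× []      N v = ≈-refl
  sumᴸ-× (a ∷ L) N v = ≈-trans (∙-congˡ (sumᴸ-× L N v)) (≈-sym (×-homo-+ v (N a) _))

  sum-× : ∀ n (N : Fin n → ℕ) v → sum (λ i → N i times v) ≈ Vector.foldr _+_ 0 N times v
  sum-× zero    N v = ≈-refl
  sum-× (suc n) N v = ≈-trans (∙-congˡ (sum-× n (N ∘ suc) v)) (≈-sym (×-homo-+ v (N zero) _))

-- Permutations as injective self-maps

==ᶠ-sound : ∀ {m} {i j : Fin m} → i ==ᶠ j ≡ true → i ≡ j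
==ᶠ-sound {i = i} {j} eq with i ≟ j
... | yes i≡j = i≡j

==ᶠ-refl : ∀ {m} (i : Fin m) → i ==ᶠ i ≡ true
==ᶠ-refl i with i ≟ i
... | yes _   = refl
... | no i≢i = contradiction refl i≢i

==ᶠ-false⇒≢ : ∀ {m} {i j : Fin m} → i ==ᶠ j ≡ false → i ≢ j
==ᶠ-false⇒≢ {i = i} eq refl with () ← trans (sym (==ᶠ-refl i)) eq

∧-≡-true : ∀ {a b} → a ∧ b ≡ true → a ≡ true × b ≡ true
∧-≡-true {true} {true} _ = refl , refl

not-true⇒≢true : ∀ {b} → not b ≡ true → b ≢ true
not-true⇒≢true {false} _ ()

∧-intro : ∀ {a b} → a ≡ true → b ≡ true → a ∧ b ≡ true
∧-intro refl refl = refl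

and-map-allFin : ∀ n (H : Fin n → Bool) → and (map H (allFin n)) ≡ true ⇔ (∀ i → H i ≡ true)
and-map-allFin n H = mk⇔
  (λ eq i → to T-≡ (All.lookup (all⁺ H (allFin n) (from T-≡ eq)) (∈-allFin i)))
  (λ h → to T-≡ (all⁻ H {allFin n} (All.tabulate (λ {i} _ → from T-≡ (h i)))))

and-map-upTo : ∀ m (P : ℕ → Bool) → and (map P (upTo m)) ≡ true ⇔ (∀ t → t < m → P t ≡ true)
and-map-upTo m P = mk⇔
  (λ eq t t<m → to T-≡ (All.lookup (all⁺ P (upTo m) (from T-≡ eq)) (∈-upTo⁺ t<m)))
  (λ h → to T-≡ (all⁻ P {upTo m} (All.tabulate (λ {t} t∈ → from T-≡ (h t (∈-upTo⁻ t∈))))))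

or-map-upTo : ∀ m (P : ℕ → Bool) → or (map P (upTo m)) ≡ true ⇔ (∃[ t ] t < m × P t ≡ true)
or-map-upTo m P = mk⇔
  (λ eq → let t , t∈ , Pt = find (any⁻ P (upTo m) (from T-≡ eq)) in t , ∈-upTo⁻ t∈ , to T-≡ Pt)
  (λ (t , t<m , Pt) → to T-≡ (any⁺ P (lose (∈-upTo⁺ t<m) (from T-≡ Pt))))

and-++ : ∀ xs ys → and (xs ++ ys) ≡ and xs ∧ and ys
and-++ []       ys = refl
and-++ (x ∷ xs) ys = trans (cong (x ∧_) (and-++ xs ys)) (sym (∧-assoc x _ _))

and-concatMap : ∀ {a} {X : Set a} (L : List X) (h : X → List Bool) →
                and (concatMap h L) ≡ and (map (and ∘ h) L)
and-concatMap []      h = refl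
and-concatMap (x ∷ L) h = trans (and-++ (h x) (concatMap h L)) (cong (and (h x) ∧_) (and-concatMap L h))

module _ {m} (σ : Fin m → Fin m) where

  private
    cell : Fin m → Fin m → Bool
    cell i j = (i ==ᶠ j) ∨ not (σ i ==ᶠ σ j)

    cell-⇔ : ∀ i j → cell i j ≡ true ⇔ (σ i ≡ σ j → i ≡ j)
    cell-⇔ i j = mk⇔ sound complete
      where
      sound : cell i j ≡ true → σ i ≡ σ j → i ≡ j
      sound eq σi≡σj with i ==ᶠ j in i=j
      ... | true  = ==ᶠ-sound i=j
      ... | false rewrite σi≡σj | ==ᶠ-refl (σ j) with () ← eq
      complete : (σ i ≡ σ j → i ≡ j) → cell i j ≡ true
      complete inj with i ==ᶠ j in i=j
      ... | true = refl
      ... | false with σ i ==ᶠ σ j in σi=σj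
      ...   | true  = contradiction (inj (==ᶠ-sound σi=σj)) (==ᶠ-false⇒≢ i=j)
      ...   | false = refl

  isInjectiveᵇ-⇔ : isInjectiveᵇ σ ≡ true ⇔ Injective _≡_ _≡_ σ
  isInjectiveᵇ-⇔ = mk⇔
    (λ eq {i} {j} → to (cell-⇔ i j) (to rows (trans (sym unfold) eq) i j))
    (λ inj → trans unfold (from rows (λ i j → from (cell-⇔ i j) inj)))
    where
    unfold = and-concatMap (allFin m) (λ i → map (cell i) (allFin m))
    rows : and (map (λ i → and (map (cell i) (allFin m))) (allFin m)) ≡ true ⇔ (∀ i j → cell i j ≡ true)
    rows = mk⇔ (λ eq i → to (and-map-allFin m (cell i)) (to (and-map-allFin m _) eq i))
               (λ h → from (and-map-allFin m _) (λ i → from (and-map-allFin m (cell i)) (h i)))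

isInjectiveᵇ-cong : ∀ {m} {σ σ′ : Fin m → Fin m} → σ ≗ σ′ → isInjectiveᵇ σ ≡ isInjectiveᵇ σ′
isInjectiveᵇ-cong σ≗σ′ = ⇔→≡ (mk⇔ (transfer σ≗σ′) (transfer (sym ∘ σ≗σ′)))
  where
  transfer : ∀ {m} {σ₁ σ₂ : Fin m → Fin m} → σ₁ ≗ σ₂ → isInjectiveᵇ σ₁ ≡ true → isInjectiveᵇ σ₂ ≡ true
  transfer {σ₁ = σ₁} {σ₂} σ₁≗σ₂ σ₁-inj = from (isInjectiveᵇ-⇔ σ₂) λ {i} {j} σ₂i≡σ₂j →
    to (isInjectiveᵇ-⇔ σ₁) σ₁-inj (trans (σ₁≗σ₂ i) (trans σ₂i≡σ₂j (sym (σ₁≗σ₂ j))))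

_≗ᵇ_ : ∀ {m n} → (Fin m → Fin n) → (Fin m → Fin n) → Bool
_≗ᵇ_ {m} g h = and (map (λ i → g i ==ᶠ h i) (allFin m))

≗ᵇ-⇔ : ∀ {m n} (g h : Fin m → Fin n) → g ≗ᵇ h ≡ true ⇔ g ≗ h
≗ᵇ-⇔ {m} g h = mk⇔
  (λ eq i → ==ᶠ-sound (to (and-map-allFin m _) eq i))
  (λ g≗h → from (and-map-allFin m _) (λ i → subst (λ z → g i ==ᶠ z ≡ true) (g≗h i) (==ᶠ-refl (g i))))

≗ᵇ-sym : ∀ {m n} (g h : Fin m → Fin n) → g ≗ᵇ h ≡ h ≗ᵇ g
≗ᵇ-sym g h = ⇔→≡ (mk⇔ (λ eq → from (≗ᵇ-⇔ h g) (sym ∘ to (≗ᵇ-⇔ g h) eq))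
                      (λ eq → from (≗ᵇ-⇔ g h) (sym ∘ to (≗ᵇ-⇔ h g) eq)))

≗ᵇ-∷ : ∀ {m n} (x : Fin n) (g : Fin m → Fin n) (h : Fin (suc m) → Fin n) →
       (x ∷ᶠ g) ≗ᵇ h ≡ (g ≗ᵇ (h ∘ suc)) ∧ (x ==ᶠ h zero)
≗ᵇ-∷ {m} x g h = trans (cong (λ bs → (x ==ᶠ h zero) ∧ and bs)
  (trans (map-tabulate {n = m} suc _) (sym (map-tabulate {n = m} (λ i → i) _)))) (∧-comm (x ==ᶠ h zero) _)

module ℕΣ = BigOperators ℕₚ.+-0-commutativeMonoid
open ℕΣ using (sum-syntax) renaming (sumᴸ to sumᴸℕ)

sum-indicator : ∀ n (i : Fin n) → ∑[ l < n ] [ l ==ᶠ i ] ≡ 1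
sum-indicator n i = ℕΣ.sum-when-unique n (_==ᶠ i) (λ _ → 1) i (==ᶠ-refl i) (λ _ → ==ᶠ-sound)

allFuns-count : ∀ m n (h : Fin m → Fin n) → sumᴸℕ (allFuns m n) (λ g → [ g ≗ᵇ h ]) ≡ 1
allFuns-count zero    n h = refl
allFuns-count (suc m) n h = begin
  sumᴸℕ (concatMap (λ g → map (_∷ᶠ g) (allFin n)) (allFuns m n)) (λ g → [ g ≗ᵇ h ])
    ≡⟨ ℕΣ.sumᴸ-concatMap (allFuns m n) _ _ ⟩
  sumᴸℕ (allFuns m n) (λ g → sumᴸℕ (map (_∷ᶠ g) (allFin n)) (λ g′ → [ g′ ≗ᵇ h ]))
    ≡⟨ ℕΣ.sumᴸ-cong (allFuns m n) (λ g → trans (ℕΣ.sumᴸ-map (allFin n) _ _) (ℕΣ.sumᴸ-allFin n _)) ⟩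
  sumᴸℕ (allFuns m n) (λ g → ∑[ x < n ] [ (x ∷ᶠ g) ≗ᵇ h ])
    ≡⟨ ℕΣ.sumᴸ-cong (allFuns m n) extensions ⟩
  sumᴸℕ (allFuns m n) (λ g → [ g ≗ᵇ (h ∘ suc) ])
    ≡⟨ allFuns-count m n (h ∘ suc) ⟩
  1 ∎
  where
  open ≡.≡-Reasoning
  single : ∀ b → ∑[ x < n ] [ b ∧ (x ==ᶠ h zero) ] ≡ [ b ]
  single true  = sum-indicator n (h zero)
  single false = ℕΣ.sum-zero n _ (λ _ → refl)
  extensions : ∀ g → ∑[ x < n ] [ (x ∷ᶠ g) ≗ᵇ h ] ≡ [ g ≗ᵇ (h ∘ suc) ]
  extensions g = trans (ℕΣ.sum-cong-≋ (λ x → cong [_] (≗ᵇ-∷ x g h))) (single (g ≗ᵇ (h ∘ suc)))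

injective-count : ∀ m (h : Fin m → Fin m) →
                  sumᴸℕ (allFuns m m) (λ g → [ isInjectiveᵇ g ∧ g ≗ᵇ h ]) ≡ [ isInjectiveᵇ h ]
injective-count m h = trans (ℕΣ.sumᴸ-cong (allFuns m m) (cong [_] ∘ transport)) (count (isInjectiveᵇ h))
  where
  transport : ∀ g → isInjectiveᵇ g ∧ g ≗ᵇ h ≡ isInjectiveᵇ h ∧ g ≗ᵇ h
  transport g with g ≗ᵇ h in g=h
  ... | true  = trans (∧-identityʳ _) (trans (isInjectiveᵇ-cong (to (≗ᵇ-⇔ g h) g=h)) (sym (∧-identityʳ _)))
  ... | false = trans (∧-zeroʳ _) (sym (∧-zeroʳ _))
  count : ∀ b → sumᴸℕ (allFuns m m) (λ g → [ b ∧ g ≗ᵇ h ]) ≡ [ b ]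
  count true  = allFuns-count m m h
  count false = ℕΣ.sumᴸ-zero (allFuns m m) _ (λ _ → refl)

-- Inserting a new point 0

shiftDown : ∀ {m} → Fin m → Fin (suc m) → Fin m
shiftDown d zero    = d
shiftDown d (suc y) = y

shiftDown-suc : ∀ {m} (d : Fin m) {y : Fin (suc m)} → y ≢ zero → suc (shiftDown d y) ≡ y
shiftDown-suc d {zero}  y≢0 = contradiction refl y≢0
shiftDown-suc d {suc y} _   = refl

-- Indices of τ are shifted up by one. `insertZero τ zero` adds 0 as a fixed point;
-- `insertZero τ (suc i)` inserts 0 into the cycle of τ right after i.
insertZero : ∀ {m} → (Fin m → Fin m) → Fin (suc m) → Fin (suc m) → Fin (suc m)
insertZero τ zero    zero    = zero
insertZero τ zero    (suc l) = suc (τ l)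
insertZero τ (suc i) zero    = suc (τ i)
insertZero τ (suc i) (suc l) = if l ==ᶠ i then zero else suc (τ l)

source : ∀ {m} → Fin (suc m) → Fin m → Fin (suc m)
source zero    l = suc l
source (suc i) l = if l ==ᶠ i then zero else suc l

deleteZero : ∀ {m} → Fin (suc m) → (Fin (suc m) → Fin (suc m)) → Fin m → Fin m
deleteZero c σ l = shiftDown l (σ (source c l))

insertZero-source : ∀ {m} (τ : Fin m → Fin m) c l → insertZero τ c (source c l) ≡ suc (τ l)
insertZero-source τ zero    l = refl
insertZero-source τ (suc i) l with l ==ᶠ i in l=i
... | true rewrite ==ᶠ-sound l=i = refl
... | false rewrite l=i = refl

source-injective : ∀ {m} (c : Fin (suc m)) → Injective _≡_ _≡_ (source c)
source-injective zero    = suc-injective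
source-injective (suc i) {l} {l′} eq with l ==ᶠ i in l=i | l′ ==ᶠ i in l′=i
... | true  | true  = trans (==ᶠ-sound l=i) (sym (==ᶠ-sound l′=i))
... | false | false = suc-injective eq

source-≢ : ∀ {m} (c : Fin (suc m)) l → source c l ≢ c
source-≢ (suc i) l eq with l ==ᶠ i in l=i
source-≢ (suc i) l () | true
source-≢ (suc i) l eq | false = ==ᶠ-false⇒≢ l=i (suc-injective eq)

insertZero-elsewhere : ∀ {m} (τ : Fin m → Fin m) i l → l ==ᶠ i ≡ false → insertZero τ (suc i) (suc l) ≡ suc (τ l)
insertZero-elsewhere τ i l l≠i rewrite l≠i = refl

insertZero-cong : ∀ {m} {τ τ′ : Fin m → Fin m} → τ ≗ τ′ → ∀ c → insertZero τ c ≗ insertZero τ′ c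
insertZero-cong τ≗τ′ zero    zero    = refl
insertZero-cong τ≗τ′ zero    (suc l) = cong suc (τ≗τ′ l)
insertZero-cong τ≗τ′ (suc i) zero    = cong suc (τ≗τ′ i)
insertZero-cong τ≗τ′ (suc i) (suc l) with l ==ᶠ i
... | true  = refl
... | false = cong suc (τ≗τ′ l)

insertZero-injective : ∀ {m} {τ : Fin m → Fin m} → Injective _≡_ _≡_ τ → ∀ c → Injective _≡_ _≡_ (insertZero τ c)
insertZero-injective inj zero    {zero}  {zero}  eq = refl
insertZero-injective inj zero    {suc l} {suc l′} eq = cong suc (inj (suc-injective eq))
insertZero-injective inj (suc i) {zero}  {zero}  eq = refl
insertZero-injective inj (suc i) {zero}  {suc l} eq with l ==ᶠ i in l=i
... | false = contradiction (inj (suc-injective eq)) (≢-sym (==ᶠ-false⇒≢ l=i))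
insertZero-injective inj (suc i) {suc l} {zero}  eq with l ==ᶠ i in l=i
... | false = contradiction (inj (suc-injective eq)) (==ᶠ-false⇒≢ l=i)
insertZero-injective inj (suc i) {suc l} {suc l′} eq with l ==ᶠ i in l=i | l′ ==ᶠ i in l′=i
... | true  | true  = cong suc (trans (==ᶠ-sound l=i) (sym (==ᶠ-sound l′=i)))
... | false | false = cong suc (inj (suc-injective eq))

insertZero⇒deleteZero : ∀ {m} (τ : Fin m → Fin m) c σ → insertZero τ c ≗ σ → τ ≗ deleteZero c σ
insertZero⇒deleteZero τ c σ eq l = cong (shiftDown l) (trans (sym (insertZero-source τ c l)) (eq (source c l)))

module _ {m} (σ : Fin (suc m) → Fin (suc m)) (inj : Injective _≡_ _≡_ σ) (c : Fin (suc m)) (σc≡0 : σ c ≡ zero) where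

  suc-deleteZero : ∀ l → suc (deleteZero c σ l) ≡ σ (source c l)
  suc-deleteZero l = shiftDown-suc l (λ σl≡0 → source-≢ c l (inj (trans σl≡0 (sym σc≡0))))

  deleteZero-injective : Injective _≡_ _≡_ (deleteZero c σ)
  deleteZero-injective {l} {l′} eq =
    source-injective c (inj (trans (sym (suc-deleteZero l)) (trans (cong suc eq) (suc-deleteZero l′))))

insertZero-deleteZero : ∀ {m} (σ : Fin (suc m) → Fin (suc m)) → Injective _≡_ _≡_ σ →
                        ∀ c → σ c ≡ zero → insertZero (deleteZero c σ) c ≗ σ
insertZero-deleteZero σ inj zero    σc≡0 zero    = sym σc≡0
insertZero-deleteZero σ inj zero    σc≡0 (suc l) = suc-deleteZero σ inj zero σc≡0 l
insertZero-deleteZero σ inj (suc i) σc≡0 zero    =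
  trans (suc-deleteZero σ inj (suc i) σc≡0 i) (cong (λ b → σ (if b then zero else suc i)) (==ᶠ-refl i))
insertZero-deleteZero σ inj (suc i) σc≡0 (suc l) with l ==ᶠ i in l=i
... | true rewrite ==ᶠ-sound l=i = sym σc≡0
... | false = shiftDown-suc l (λ σl≡0 → ==ᶠ-false⇒≢ l=i (suc-injective (inj (trans σl≡0 (sym σc≡0)))))

insertZero-self : ∀ {m} (τ : Fin m → Fin m) c → insertZero τ c c ≡ zero
insertZero-self τ zero    = refl
insertZero-self τ (suc i) rewrite ==ᶠ-refl i = refl

insertZero-≗ᵇ : ∀ {m} (σ : Fin (suc m) → Fin (suc m)) → Injective _≡_ _≡_ σ → ∀ (τ : Fin m → Fin m) c →
                insertZero τ c ≗ᵇ σ ≡ (σ c ==ᶠ zero) ∧ (τ ≗ᵇ deleteZero c σ)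
insertZero-≗ᵇ {m} σ inj τ c = ⇔→≡ (mk⇔
  (λ eq → let τ↑≗σ = to (≗ᵇ-⇔ _ σ) eq in
    ∧-intro (subst (λ x → x ==ᶠ zero ≡ true) (trans (sym (insertZero-self τ c)) (τ↑≗σ c)) (==ᶠ-refl {suc m} zero))
            (from (≗ᵇ-⇔ τ _) (insertZero⇒deleteZero τ c σ τ↑≗σ)))
  (λ eq → let σc=0 , τ=del = ∧-≡-true eq in from (≗ᵇ-⇔ _ σ) (λ x →
    trans (insertZero-cong (to (≗ᵇ-⇔ τ _) τ=del) c x) (insertZero-deleteZero σ inj c (==ᶠ-sound σc=0) x))))

zero-preimage : ∀ {m} (σ : Fin (suc m) → Fin (suc m)) → Injective _≡_ _≡_ σ → ∃[ c ] σ c ≡ zero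
zero-preimage {m} σ inj with any? (λ c → σ c ≟ zero)
... | yes hit = hit
... | no ¬hit = contradiction (injective⇒≤ punchedInjective) ℕₚ.1+n≰n
  where
  σ≢0 : ∀ c → σ c ≢ zero
  σ≢0 c eq = ¬hit (c , eq)
  punched : Fin (suc m) → Fin m
  punched c = punchOut (≢-sym (σ≢0 c))
  punchedInjective : Injective _≡_ _≡_ punched
  punchedInjective {x} {y} eq = inj (punchOut-injective (≢-sym (σ≢0 x)) (≢-sym (σ≢0 y)) eq)

zero-preimage-count : ∀ {m} (σ : Fin (suc m) → Fin (suc m)) → Injective _≡_ _≡_ σ →
                      ∑[ c < suc m ] [ σ c ==ᶠ zero ] ≡ 1
zero-preimage-count {m} σ inj with c , σc≡0 ← zero-preimage σ inj =
  ℕΣ.sum-when-unique _ (λ c → σ c ==ᶠ zero) (λ _ → 1) c (subst (λ x → x ==ᶠ zero ≡ true) (sym σc≡0) (==ᶠ-refl {suc m} zero))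
                     (λ c′ σc′=0 → inj (trans (==ᶠ-sound σc′=0) (sym σc≡0)))

insertZero-fibre-count : ∀ {m} (σ : Fin (suc m) → Fin (suc m)) → Injective _≡_ _≡_ σ →
                         sumᴸℕ (allFuns m m) (λ τ → ∑[ c < suc m ] [ isInjectiveᵇ τ ∧ insertZero τ c ≗ᵇ σ ]) ≡ 1
insertZero-fibre-count {m} σ inj = begin
  sumᴸℕ (allFuns m m) (λ τ → ∑[ c < suc m ] [ isInjectiveᵇ τ ∧ insertZero τ c ≗ᵇ σ ])
    ≡⟨ ℕΣ.sumᴸ-comm-sum (allFuns m m) (suc m) (λ τ c → [ isInjectiveᵇ τ ∧ insertZero τ c ≗ᵇ σ ]) ⟩
  ∑[ c < suc m ] sumᴸℕ (allFuns m m) (λ τ → [ isInjectiveᵇ τ ∧ insertZero τ c ≗ᵇ σ ])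
    ≡⟨ ℕΣ.sum-cong-≗ fibre ⟩
  ∑[ c < suc m ] [ σ c ==ᶠ zero ]
    ≡⟨ zero-preimage-count σ inj ⟩
  1 ∎
  where
  open ≡.≡-Reasoning
  fibreᵇ : ∀ c b → b ≡ σ c ==ᶠ zero →
           sumᴸℕ (allFuns m m) (λ τ → [ isInjectiveᵇ τ ∧ (b ∧ τ ≗ᵇ deleteZero c σ) ]) ≡ [ b ]
  fibreᵇ c true  σc=0 = trans (injective-count m (deleteZero c σ))
    (cong [_] (from (isInjectiveᵇ-⇔ _) (deleteZero-injective σ inj c (==ᶠ-sound (sym σc=0)))))
  fibreᵇ c false _    = ℕΣ.sumᴸ-zero (allFuns m m) _ (λ τ → cong [_] (∧-zeroʳ (isInjectiveᵇ τ)))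
  fibre : ∀ c → sumᴸℕ (allFuns m m) (λ τ → [ isInjectiveᵇ τ ∧ insertZero τ c ≗ᵇ σ ]) ≡ [ σ c ==ᶠ zero ]
  fibre c = trans (ℕΣ.sumᴸ-cong (allFuns m m) (λ τ → cong (λ b → [ isInjectiveᵇ τ ∧ b ]) (insertZero-≗ᵇ σ inj τ c)))
                  (fibreᵇ c (σ c ==ᶠ zero) refl)

-- Inversions

<ᵇ-irrefl : ∀ n → (n <ᵇ n) ≡ false
<ᵇ-irrefl zero    = refl
<ᵇ-irrefl (suc n) = <ᵇ-irrefl n

<⇒<ᵇ≡true : ∀ {m n} → m < n → (m <ᵇ n) ≡ true
<⇒<ᵇ≡true m<n = to T-≡ (ℕₚ.<⇒<ᵇ m<n)

≮⇒<ᵇ≡false : ∀ {m n} → ¬ m < n → (m <ᵇ n) ≡ false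
≮⇒<ᵇ≡false {m} {n} m≮n with m <ᵇ n in m<n
... | true  = contradiction (ℕₚ.<ᵇ⇒< m n (from T-≡ m<n)) m≮n
... | false = refl

sum-pick : ∀ n (i : Fin n) (Y : Fin n → ℕ) → ∑[ l < n ] ([ l ==ᶠ i ] * Y l) ≡ Y i
sum-pick n i Y = trans (ℕΣ.sum-cong-≗ (λ l → pick (l ==ᶠ i) (Y l)))
                       (ℕΣ.sum-when-unique n (_==ᶠ i) Y i (==ᶠ-refl i) (λ _ → ==ᶠ-sound))
  where
  pick : ∀ b y → [ b ] * y ≡ ℕΣ.when b y
  pick true  y = ℕₚ.+-identityʳ y
  pick false y = refl

sum-below : ∀ n (i : Fin n) → ∑[ l < n ] [ toℕ l <ᵇ toℕ i ] ≡ toℕ i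
sum-below (suc n) zero    = ℕΣ.sum-zero n _ (λ _ → refl)
sum-below (suc n) (suc i) = cong suc (sum-below n i)

inverted : ∀ {m} → (Fin m → Fin m) → Fin m → Fin m → Bool
inverted σ i j = (toℕ i <ᵇ toℕ j) ∧ (toℕ (σ j) <ᵇ toℕ (σ i))

inversionCount : ∀ {m} → (Fin m → Fin m) → ℕ
inversionCount {m} σ = ∑[ i < m ] ∑[ j < m ] [ inverted σ i j ]

length-filter-true : ∀ (bs : List Bool) → length (filterᵇ (λ b → b) bs) ≡ sumᴸℕ bs [_]
length-filter-true []           = refl
length-filter-true (true  ∷ bs) = cong suc (length-filter-true bs)
length-filter-true (false ∷ bs) = length-filter-true bs

inversions≡inversionCount : ∀ {m} (σ : Fin m → Fin m) → inversions σ ≡ inversionCount σ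
inversions≡inversionCount {m} σ = begin
  inversions σ
    ≡⟨ length-filter-true (concatMap (λ i → map (inverted σ i) (allFin m)) (allFin m)) ⟩
  sumᴸℕ (concatMap (λ i → map (inverted σ i) (allFin m)) (allFin m)) [_]
    ≡⟨ ℕΣ.sumᴸ-concatMap (allFin m) _ _ ⟩
  sumᴸℕ (allFin m) (λ i → sumᴸℕ (map (inverted σ i) (allFin m)) [_])
    ≡⟨ ℕΣ.sumᴸ-allFin m _ ⟩
  ∑[ i < m ] sumᴸℕ (map (inverted σ i) (allFin m)) [_]
    ≡⟨ ℕΣ.sum-cong-≗ (λ i → trans (ℕΣ.sumᴸ-map (allFin m) (inverted σ i) [_]) (ℕΣ.sumᴸ-allFin m _)) ⟩
  inversionCount σ ∎
  where open ≡.≡-Reasoning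

inversions-cong : ∀ {m} {σ σ′ : Fin m → Fin m} → σ ≗ σ′ → inversions σ ≡ inversions σ′
inversions-cong {σ = σ} {σ′} σ≗σ′ = begin
  inversions σ      ≡⟨ inversions≡inversionCount σ ⟩
  inversionCount σ  ≡⟨ ℕΣ.sum-cong-≗ (λ i → ℕΣ.sum-cong-≗ (λ j →
                         cong₂ (λ a b → [ (toℕ i <ᵇ toℕ j) ∧ (toℕ a <ᵇ toℕ b) ]) (σ≗σ′ j) (σ≗σ′ i))) ⟩
  inversionCount σ′ ≡⟨ inversions≡inversionCount σ′ ⟨
  inversions σ′     ∎
  where open ≡.≡-Reasoning

inversions-insertZero-fixed : ∀ {m} (τ : Fin m → Fin m) → inversions (insertZero τ zero) ≡ inversions τ
inversions-insertZero-fixed {m} τ = begin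
  inversions (insertZero τ zero)     ≡⟨ inversions≡inversionCount (insertZero τ zero) ⟩
  inversionCount (insertZero τ zero) ≡⟨ cong (_+ inversionCount τ) (ℕΣ.sum-zero m _ (λ _ → refl)) ⟩
  inversionCount τ                   ≡⟨ inversions≡inversionCount τ ⟨
  inversions τ                       ∎
  where open ≡.≡-Reasoning

module _ {m} (τ : Fin m → Fin m) (i : Fin m) where

  private
    σ : Fin (suc m) → Fin (suc m)
    σ = insertZero τ (suc i)

    t : Fin m → Fin m → ℕ
    t l l′ = [ inverted τ l l′ ]

  inverted-insertZero-zero : ∀ l → [ inverted σ zero (suc l) ] ≡ [ l ==ᶠ i ] + [ toℕ (τ l) <ᵇ toℕ (τ i) ]
  inverted-insertZero-zero l with l ==ᶠ i in l=i
  ... | true rewrite ==ᶠ-sound l=i | <ᵇ-irrefl (toℕ (τ i)) = refl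
  ... | false = refl

  inverted-insertZero-suc : ∀ l l′ → [ inverted σ (suc l) (suc l′) ] + [ l ==ᶠ i ] * t l l′ + [ l′ ==ᶠ i ] * t l l′
                                     ≡ t l l′ + [ l′ ==ᶠ i ] * [ toℕ l <ᵇ toℕ i ]
  inverted-insertZero-suc l l′ with l ==ᶠ i in l=i | l′ ==ᶠ i in l′=i
  ... | true  | true  rewrite ==ᶠ-sound l=i | ==ᶠ-sound l′=i | <ᵇ-irrefl (toℕ i) = refl
  ... | true  | false rewrite ==ᶠ-sound l=i | ∧-zeroʳ (toℕ i <ᵇ toℕ l′) = ℕₚ.+-identityʳ (t i l′ + 0)
  ... | false | true  rewrite ==ᶠ-sound l′=i | ∧-identityʳ (toℕ l <ᵇ toℕ i) =
    trans (cong ([ toℕ l <ᵇ toℕ i ] + 0 +_) (ℕₚ.+-identityʳ (t l i))) (ℕₚ.+-comm ([ toℕ l <ᵇ toℕ i ] + 0) (t l i))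
  ... | false | false = ℕₚ.+-identityʳ _

  below-τi : Injective _≡_ _≡_ τ → ∀ l → [ toℕ (τ l) <ᵇ toℕ (τ i) ] + t l i ≡ t i l + [ toℕ l <ᵇ toℕ i ]
  below-τi inj l with ℕₚ.<-cmp (toℕ l) (toℕ i)
  ... | tri< l<i _ l≯i rewrite <⇒<ᵇ≡true l<i | ≮⇒<ᵇ≡false l≯i = exactlyOne
    where
    exactlyOne : [ toℕ (τ l) <ᵇ toℕ (τ i) ] + [ toℕ (τ i) <ᵇ toℕ (τ l) ] ≡ 1
    exactlyOne with ℕₚ.<-cmp (toℕ (τ l)) (toℕ (τ i))
    ... | tri< τl<τi _ τl≯τi rewrite <⇒<ᵇ≡true τl<τi | ≮⇒<ᵇ≡false τl≯τi = refl
    ... | tri≈ _ τl≡τi _ = contradiction (inj (toℕ-injective τl≡τi)) (λ l≡i → ℕₚ.<-irrefl (cong toℕ l≡i) l<i)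
    ... | tri> τl≮τi _ τl>τi rewrite ≮⇒<ᵇ≡false τl≮τi | <⇒<ᵇ≡true τl>τi = refl
  ... | tri≈ _ l≡i _ rewrite toℕ-injective l≡i | <ᵇ-irrefl (toℕ i) | <ᵇ-irrefl (toℕ (τ i)) = refl
  ... | tri> l≮i _ l>i rewrite ≮⇒<ᵇ≡false l≮i | <⇒<ᵇ≡true l>i = refl

  private
    open Algebra.Properties.Semiring.Sum ℕₚ.+-*-semiring using (*-distribˡ-sum)

    A b c I Q : ℕ
    A = ∑[ l < m ] [ toℕ (τ l) <ᵇ toℕ (τ i) ]
    b = ∑[ l < m ] t l i
    c = ∑[ l < m ] t i l
    I = toℕ i
    Q = ∑[ l < m ] ∑[ l′ < m ] [ inverted σ (suc l) (suc l′) ]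

    q rowTerm colTerm lowerTerm : Fin m → Fin m → ℕ
    q l l′ = [ inverted σ (suc l) (suc l′) ]
    rowTerm l l′ = [ l ==ᶠ i ] * t l l′
    colTerm l l′ = [ l′ ==ᶠ i ] * t l l′
    lowerTerm l l′ = [ l′ ==ᶠ i ] * [ toℕ l <ᵇ toℕ i ]

    zeroRow : ∑[ l < m ] [ inverted σ zero (suc l) ] ≡ suc A
    zeroRow = begin
      ∑[ l < m ] [ inverted σ zero (suc l) ]                    ≡⟨ ℕΣ.sum-cong-≗ inverted-insertZero-zero ⟩
      ∑[ l < m ] ([ l ==ᶠ i ] + [ toℕ (τ l) <ᵇ toℕ (τ i) ])    ≡⟨ ℕΣ.∑-distrib-+ (λ l → [ l ==ᶠ i ]) _ ⟩
      ∑[ l < m ] [ l ==ᶠ i ] + A                                ≡⟨ cong (_+ A) (sum-indicator m i) ⟩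
      suc A                                                     ∎
      where open ≡.≡-Reasoning

    below-count : Injective _≡_ _≡_ τ → A + b ≡ c + I
    below-count inj = begin
      A + b                                                     ≡⟨ ℕΣ.∑-distrib-+ _ (λ l → t l i) ⟨
      ∑[ l < m ] ([ toℕ (τ l) <ᵇ toℕ (τ i) ] + t l i)         ≡⟨ ℕΣ.sum-cong-≗ (below-τi inj) ⟩
      ∑[ l < m ] (t i l + [ toℕ l <ᵇ toℕ i ])                 ≡⟨ ℕΣ.∑-distrib-+ (t i) _ ⟩
      c + ∑[ l < m ] [ toℕ l <ᵇ toℕ i ]                        ≡⟨ cong (c +_) (sum-below m i) ⟩
      c + I                                                     ∎
      where open ≡.≡-Reasoning

    rowSum : ∑[ l < m ] ∑[ l′ < m ] rowTerm l l′ ≡ c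
    rowSum = trans (ℕΣ.sum-cong-≗ {m} (λ l → sym (*-distribˡ-sum [ l ==ᶠ i ] (t l)))) (sum-pick m i (λ l → ∑[ l′ < m ] t l l′))

    colSum : ∑[ l < m ] ∑[ l′ < m ] colTerm l l′ ≡ b
    colSum = ℕΣ.sum-cong-≗ (λ l → sum-pick m i (t l))

    lowerSum : ∑[ l < m ] ∑[ l′ < m ] lowerTerm l l′ ≡ I
    lowerSum = trans (ℕΣ.sum-cong-≗ {m} (λ l → sum-pick m i (λ _ → [ toℕ l <ᵇ toℕ i ]))) (sum-below m i)

    otherRows : Q + c + b ≡ inversionCount τ + I
    otherRows = begin
      Q + c + b
        ≡⟨ cong₂ (λ x y → Q + x + y) rowSum colSum ⟨
      Q + ∑[ l < m ] ∑[ l′ < m ] rowTerm l l′ + ∑[ l < m ] ∑[ l′ < m ] colTerm l l′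
        ≡⟨ cong (_+ ∑[ l < m ] ∑[ l′ < m ] colTerm l l′) (ℕΣ.∑∑-distrib-+ q rowTerm) ⟨
      ∑[ l < m ] ∑[ l′ < m ] (q l l′ + rowTerm l l′) + ∑[ l < m ] ∑[ l′ < m ] colTerm l l′
        ≡⟨ ℕΣ.∑∑-distrib-+ (λ l l′ → q l l′ + rowTerm l l′) colTerm ⟨
      ∑[ l < m ] ∑[ l′ < m ] (q l l′ + rowTerm l l′ + colTerm l l′)
        ≡⟨ ℕΣ.sum-cong-≗ (λ l → ℕΣ.sum-cong-≗ (inverted-insertZero-suc l)) ⟩
      ∑[ l < m ] ∑[ l′ < m ] (t l l′ + lowerTerm l l′)
        ≡⟨ ℕΣ.∑∑-distrib-+ t lowerTerm ⟩
      inversionCount τ + ∑[ l < m ] ∑[ l′ < m ] lowerTerm l l′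
        ≡⟨ cong (inversionCount τ +_) lowerSum ⟩
      inversionCount τ + I ∎
      where open ≡.≡-Reasoning

  -- With A = #{l | τ l < τ i}, b = #{l | (l, i) inverted}, c = #{l | (i, l) inverted}: the pairs
  -- (0, l + 1) contribute 1 + A, the other pairs inversionCount τ + i − b − c, and A + b = c + i.
  inversionCount-insertZero-suc : Injective _≡_ _≡_ τ →
    ∃[ b ] inversionCount σ + (b + b) ≡ suc (inversionCount τ + (toℕ i + toℕ i))
  inversionCount-insertZero-suc inj = b , (begin
    inversionCount σ + (b + b)              ≡⟨ cong (λ r → r + Q + (b + b)) zeroRow ⟩
    suc A + Q + (b + b)                     ≡⟨ solve 3 (λ A Q b → con 1 :+ A :+ Q :+ (b :+ b)
                                                            := con 1 :+ (A :+ b) :+ (Q :+ b)) refl A Q b ⟩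
    suc (A + b) + (Q + b)                   ≡⟨ cong (λ x → suc x + (Q + b)) (below-count inj) ⟩
    suc (c + I) + (Q + b)                   ≡⟨ solve 4 (λ I Q b c → con 1 :+ (c :+ I) :+ (Q :+ b)
                                                              := con 1 :+ (I :+ (Q :+ c :+ b))) refl I Q b c ⟩
    suc (I + (Q + c + b))                   ≡⟨ cong (λ x → suc (I + x)) otherRows ⟩
    suc (I + (inversionCount τ + I))        ≡⟨ cong suc (solve 2 (λ I V → I :+ (V :+ I) := V :+ (I :+ I)) refl I (inversionCount τ)) ⟩
    suc (inversionCount τ + (I + I))        ∎)
    where
    open ≡.≡-Reasoning
    open Data.Nat.Solver.+-*-Solver

-- Cycles

module _ {m} (σ : Fin m → Fin m) where

  iter-+ : ∀ t s x → iter σ (t + s) x ≡ iter σ t (iter σ s x)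
  iter-+ zero    s x = refl
  iter-+ (suc t) s x = cong σ (iter-+ t s x)

  iter-suc : ∀ t x → iter σ (suc t) x ≡ iter σ t (σ x)
  iter-suc t x = trans (cong (λ n → iter σ n x) (ℕₚ.+-comm 1 t)) (iter-+ t 1 x)

  Reach : Fin m → Fin m → Set
  Reach x y = ∃[ t ] iter σ t x ≡ y

  Reach-refl : ∀ {x} → Reach x x
  Reach-refl = 0 , refl

  Reach-trans : ∀ {x y z} → Reach x y → Reach y z → Reach x z
  Reach-trans {x} (t , xt≡y) (s , ys≡z) = s + t , trans (iter-+ s t x) (trans (cong (iter σ s) xt≡y) ys≡z)

  Reach-step : ∀ {x y} → Reach x y → Reach x (σ y)
  Reach-step (t , xt≡y) = suc t , cong σ xt≡y

  Reach-σ : ∀ x → Reach x (σ x)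
  Reach-σ x = Reach-step Reach-refl

  iter-repeats : ∀ x → ∃[ p ] ∃[ q ] p < q × q ≤ m × iter σ q x ≡ iter σ p x
  iter-repeats x with pigeonhole (ℕₚ.n<1+n m) (λ j → iter σ (toℕ j) x)
  ... | p , q , p<q , eq = toℕ p , toℕ q , p<q , s≤s⁻¹ (toℕ<n q) , sym eq

  iter-size : ∀ x → ∃[ t ] t < m × iter σ m x ≡ iter σ t x
  iter-size x with p , q , p<q , q≤m , eq ← iter-repeats x = m ∸ q + p , bound , (begin
    iter σ m x               ≡⟨ cong (λ n → iter σ n x) (ℕₚ.m∸n+n≡m q≤m) ⟨
    iter σ (m ∸ q + q) x     ≡⟨ iter-+ (m ∸ q) q x ⟩
    iter σ (m ∸ q) (iter σ q x) ≡⟨ cong (iter σ (m ∸ q)) eq ⟩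
    iter σ (m ∸ q) (iter σ p x) ≡⟨ iter-+ (m ∸ q) p x ⟨
    iter σ (m ∸ q + p) x     ∎)
    where
    open ≡.≡-Reasoning
    bound : m ∸ q + p < m
    bound = subst (m ∸ q + p <_) (ℕₚ.m∸n+n≡m q≤m) (ℕₚ.+-monoʳ-< (m ∸ q) p<q)

  iter-below-size : ∀ x T → ∃[ t ] t < m × iter σ T x ≡ iter σ t x
  iter-below-size x zero = 0 , ℕₚ.≤-<-trans z≤n (toℕ<n x) , refl
  iter-below-size x (suc T) with t , t<m , eq ← iter-below-size x T with ℕₚ.m≤n⇒m<n∨m≡n t<m
  ... | inj₁ 1+t<m = suc t , 1+t<m , cong σ eq
  ... | inj₂ 1+t≡m with t′ , t′<m , eq′ ← iter-size x =
    t′ , t′<m , trans (cong σ eq) (trans (cong (λ n → iter σ n x) 1+t≡m) eq′)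

  inCycleᵇ-⇔ : ∀ x y → inCycleᵇ σ x y ≡ true ⇔ Reach x y
  inCycleᵇ-⇔ x y = mk⇔
    (λ eq → let t , _ , xt=y = to (or-map-upTo m _) eq in t , ==ᶠ-sound xt=y)
    (λ (T , xT≡y) → let t , t<m , eq = iter-below-size x T in
      from (or-map-upTo m _) (t , t<m , subst (λ z → iter σ t x ==ᶠ z ≡ true) (trans (sym eq) xT≡y) (==ᶠ-refl _)))

  isCycleRepᵇ-⇔ : ∀ x → isCycleRepᵇ σ x ≡ true ⇔ (∀ y → Reach x y → toℕ x ≤ toℕ y)
  isCycleRepᵇ-⇔ x = mk⇔
    (λ eq y (T , xT≡y) → let t , t<m , xT≡xt = iter-below-size x T in
      subst (λ z → toℕ x ≤ toℕ z) (trans (sym xT≡xt) xT≡y)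
            (ℕₚ.≤ᵇ⇒≤ _ _ (from T-≡ (to (and-map-upTo m _) eq t t<m))))
    (λ least → from (and-map-upTo m _) (λ t _ → to T-≡ (ℕₚ.≤⇒≤ᵇ (least _ (t , refl)))))

  module _ (inj : Injective _≡_ _≡_ σ) where

    iter-injective : ∀ t → Injective _≡_ _≡_ (iter σ t)
    iter-injective zero    eq = eq
    iter-injective (suc t) eq = iter-injective t (inj eq)

    period : ∀ x → ∃[ d ] iter σ (suc d) x ≡ x
    period x with p , q , p<q , _ , eq ← iter-repeats x = q ∸ suc p , iter-injective p (begin
      iter σ p (iter σ (suc (q ∸ suc p)) x) ≡⟨ iter-+ p _ x ⟨
      iter σ (p + suc (q ∸ suc p)) x      ≡⟨ cong (λ n → iter σ n x) (trans (ℕₚ.+-suc p _) (ℕₚ.m+[n∸m]≡n p<q)) ⟩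
      iter σ q x                           ≡⟨ eq ⟩
      iter σ p x                           ∎)
      where open ≡.≡-Reasoning

    iter-periodic : ∀ {x} d → iter σ d x ≡ x → ∀ t → iter σ (t * d) x ≡ x
    iter-periodic d xd≡x zero    = refl
    iter-periodic {x} d xd≡x (suc t) = trans (iter-+ d (t * d) x) (trans (cong (iter σ d) (iter-periodic d xd≡x t)) xd≡x)

    Reach-sym : ∀ {x y} → Reach x y → Reach y x
    Reach-sym {x} {y} (t , xt≡y) with d , x[1+d]≡x ← period x = t * d , (begin
      iter σ (t * d) y                ≡⟨ cong (iter σ (t * d)) xt≡y ⟨
      iter σ (t * d) (iter σ t x)     ≡⟨ iter-+ (t * d) t x ⟨
      iter σ (t * d + t) x            ≡⟨ cong (λ n → iter σ n x) (trans (ℕₚ.+-comm (t * d) t) (sym (ℕₚ.*-suc t d))) ⟩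
      iter σ (t * suc d) x            ≡⟨ iter-periodic (suc d) x[1+d]≡x t ⟩
      x                               ∎)
      where open ≡.≡-Reasoning

iter-cong : ∀ {m} {σ σ′ : Fin m → Fin m} → σ ≗ σ′ → ∀ t → iter σ t ≗ iter σ′ t
iter-cong σ≗σ′ zero    x = refl
iter-cong {σ = σ} σ≗σ′ (suc t) x = trans (cong σ (iter-cong σ≗σ′ t x)) (σ≗σ′ _)

inCycleᵇ-cong : ∀ {m} {σ σ′ : Fin m → Fin m} → σ ≗ σ′ → ∀ x y → inCycleᵇ σ x y ≡ inCycleᵇ σ′ x y
inCycleᵇ-cong {m} σ≗σ′ x y = cong or (map-cong (λ t → cong (_==ᶠ y) (iter-cong σ≗σ′ t x)) (upTo m))

isCycleRepᵇ-cong : ∀ {m} {σ σ′ : Fin m → Fin m} → σ ≗ σ′ → ∀ x → isCycleRepᵇ σ x ≡ isCycleRepᵇ σ′ x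
isCycleRepᵇ-cong {m} σ≗σ′ x = cong and (map-cong (λ t → cong (λ z → toℕ x ≤ᵇ toℕ z) (iter-cong σ≗σ′ t x)) (upTo m))

least-satisfying : ∀ {n} (p : Fin n → Bool) y → p y ≡ true →
                   ∃[ r ] p r ≡ true × (∀ z → p z ≡ true → toℕ r ≤ toℕ z)
least-satisfying {suc n} p y py with p zero in p0
... | true = zero , p0 , (λ _ _ → z≤n)
least-satisfying {suc n} p zero    py | false with () ← trans (sym py) p0
least-satisfying {suc n} p (suc y) py | false with r , pr , least ← least-satisfying (p ∘ suc) y py =
  suc r , pr , bound
  where
  bound : ∀ z → p z ≡ true → toℕ (suc r) ≤ toℕ z
  bound zero    pz with () ← trans (sym pz) p0
  bound (suc z) pz = s≤s (least z pz)

module CycleRepresentative {m} (τ : Fin m → Fin m) (inj : Injective _≡_ _≡_ τ) (i : Fin m) where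

  private
    leastInCycle = least-satisfying (inCycleᵇ τ i) i (from (inCycleᵇ-⇔ τ i i) (Reach-refl τ))

  rep : Fin m
  rep = proj₁ leastInCycle

  i↝rep : Reach τ i rep
  i↝rep = to (inCycleᵇ-⇔ τ i rep) (proj₁ (proj₂ leastInCycle))

  rep↝i : Reach τ rep i
  rep↝i = Reach-sym τ inj i↝rep

  rep-least : ∀ z → Reach τ i z → toℕ rep ≤ toℕ z
  rep-least z i↝z = proj₂ (proj₂ leastInCycle) z (from (inCycleᵇ-⇔ τ i z) i↝z)

  rep-isCycleRep : isCycleRepᵇ τ rep ≡ true
  rep-isCycleRep = from (isCycleRepᵇ-⇔ τ rep) (λ y rep↝y → rep-least y (Reach-trans τ i↝rep rep↝y))

  rep-unique : ∀ a → isCycleRepᵇ τ a ∧ inCycleᵇ τ a i ≡ true → a ≡ rep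
  rep-unique a eq with a-rep , a∋i ← ∧-≡-true eq = toℕ-injective (ℕₚ.≤-antisym
    (to (isCycleRepᵇ-⇔ τ a) a-rep rep (Reach-trans τ a↝i i↝rep))
    (rep-least a (Reach-sym τ inj a↝i)))
    where a↝i = to (inCycleᵇ-⇔ τ a i) a∋i

  rep-inCycle : ∀ b → inCycleᵇ τ rep b ≡ inCycleᵇ τ i b
  rep-inCycle b = ⇔→≡ (mk⇔
    (λ eq → from (inCycleᵇ-⇔ τ i b) (Reach-trans τ i↝rep (to (inCycleᵇ-⇔ τ rep b) eq)))
    (λ eq → from (inCycleᵇ-⇔ τ rep b) (Reach-trans τ rep↝i (to (inCycleᵇ-⇔ τ i b) eq))))

inCycleᵇ-≡ : ∀ {m n} {σ : Fin m → Fin m} {σ′ : Fin n → Fin n} {x y x′ y′} →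
             Reach σ x y ⇔ Reach σ′ x′ y′ → inCycleᵇ σ x y ≡ inCycleᵇ σ′ x′ y′
inCycleᵇ-≡ {σ = σ} {σ′} {x} {y} {x′} {y′} reach = ⇔→≡ (mk⇔
  (λ eq → from (inCycleᵇ-⇔ σ′ x′ y′) (to reach (to (inCycleᵇ-⇔ σ x y) eq)))
  (λ eq → from (inCycleᵇ-⇔ σ x y) (from reach (to (inCycleᵇ-⇔ σ′ x′ y′) eq))))

module _ {m} (τ : Fin m → Fin m) where

  isCycleRepᵇ-insertZero-zero : ∀ c → isCycleRepᵇ (insertZero τ c) zero ≡ true
  isCycleRepᵇ-insertZero-zero c = from (isCycleRepᵇ-⇔ (insertZero τ c) zero) (λ _ _ → z≤n)

  Reach-insertZero-step : ∀ c l → Reach (insertZero τ c) (suc l) (suc (τ l))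
  Reach-insertZero-step zero    l = Reach-σ (insertZero τ zero) (suc l)
  Reach-insertZero-step (suc i) l with l ==ᶠ i in l=i
  ... | true rewrite ==ᶠ-sound l=i = 2 , cong (insertZero τ (suc i)) (insertZero-self τ (suc i))
  ... | false = 1 , insertZero-elsewhere τ i l l=i

  Reach-insertZero-suc : ∀ c {a b} → Reach τ a b → Reach (insertZero τ c) (suc a) (suc b)
  Reach-insertZero-suc c {a} (t , at≡b) = subst (λ z → Reach (insertZero τ c) (suc a) (suc z)) at≡b (steps t)
    where
    steps : ∀ t → Reach (insertZero τ c) (suc a) (suc (iter τ t a))
    steps zero    = Reach-refl (insertZero τ c)
    steps (suc t) = Reach-trans (insertZero τ c) (steps t) (Reach-insertZero-step c (iter τ t a))

  isCycleRepᵇ-insertZero-suc : ∀ c a → (∀ b → Reach (insertZero τ c) (suc a) (suc b) → Reach τ a b) →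
    isCycleRepᵇ (insertZero τ c) (suc a) ≡ true ⇔ (isCycleRepᵇ τ a ≡ true × ¬ Reach (insertZero τ c) (suc a) zero)
  isCycleRepᵇ-insertZero-suc c a back = mk⇔
    (λ eq → let least = to (isCycleRepᵇ-⇔ σ (suc a)) eq in
      from (isCycleRepᵇ-⇔ τ a) (λ b a↝b → s≤s⁻¹ (least (suc b) (Reach-insertZero-suc c a↝b))) ,
      (λ a↝0 → contradiction (least zero a↝0) λ ()))
    (λ (a-rep , a↛0) → from (isCycleRepᵇ-⇔ σ (suc a)) λ
      { zero    a↝0 → contradiction a↝0 a↛0
      ; (suc b) a↝b → s≤s (to (isCycleRepᵇ-⇔ τ a) a-rep b (back b a↝b)) })
    where σ = insertZero τ c

  module Fixed where

    private
      σ = insertZero τ zero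

    iter-zero : ∀ t → iter σ t zero ≡ zero
    iter-zero zero    = refl
    iter-zero (suc t) = cong σ (iter-zero t)

    iter-shifted : ∀ t a → iter σ t (suc a) ≡ suc (iter τ t a)
    iter-shifted zero    a = refl
    iter-shifted (suc t) a = cong σ (iter-shifted t a)

    Reach-suc⇔ : ∀ a b → Reach σ (suc a) (suc b) ⇔ Reach τ a b
    Reach-suc⇔ a b = mk⇔ (λ (t , eq) → t , suc-injective (trans (sym (iter-shifted t a)) eq))
                         (Reach-insertZero-suc zero)

    inCycleᵇ-zero : ∀ b → inCycleᵇ σ zero (suc b) ≡ false
    inCycleᵇ-zero b with inCycleᵇ σ zero (suc b) in eq
    ... | false = refl
    ... | true with t , 0↝b ← to (inCycleᵇ-⇔ σ zero (suc b)) eq with () ← trans (sym 0↝b) (iter-zero t)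

    isCycleRepᵇ-suc : ∀ a → isCycleRepᵇ σ (suc a) ≡ isCycleRepᵇ τ a
    isCycleRepᵇ-suc a = ⇔→≡ (mk⇔ (proj₁ ∘ to repr) (λ a-rep → from repr (a-rep , unreachable)))
      where
      repr = isCycleRepᵇ-insertZero-suc zero a (λ b → to (Reach-suc⇔ a b))
      unreachable : ¬ Reach σ (suc a) zero
      unreachable (t , eq) with () ← trans (sym (iter-shifted t a)) eq

  module Inserted (i : Fin m) where

    private
      σ = insertZero τ (suc i)

    traced : ∀ t a → (iter σ t (suc a) ≡ zero → Reach τ a i) × (∀ b → iter σ t (suc a) ≡ suc b → Reach τ a b)
    traced zero    a = (λ ()) , (λ b eq → 0 , suc-injective eq)
    traced (suc t) a with iter σ t (suc a) in at
    ... | zero  = (λ ()) , (λ b eq → subst (Reach τ a) (suc-injective eq) (Reach-step τ (proj₁ (traced t a) at)))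
    ... | suc l with l ==ᶠ i in l=i
    ...   | true  = (λ _ → subst (Reach τ a) (==ᶠ-sound l=i) (proj₂ (traced t a) l at)) , (λ b ())
    ...   | false = (λ ()) , (λ b eq → subst (Reach τ a) (suc-injective eq) (Reach-step τ (proj₂ (traced t a) l at)))

    Reach-suc⇔ : ∀ a b → Reach σ (suc a) (suc b) ⇔ Reach τ a b
    Reach-suc⇔ a b = mk⇔ (λ (t , eq) → proj₂ (traced t a) b eq) (Reach-insertZero-suc (suc i))

    Reach-to-zero⇔ : ∀ a → Reach σ (suc a) zero ⇔ Reach τ a i
    Reach-to-zero⇔ a = mk⇔ (λ (t , eq) → proj₁ (traced t a) eq)
      (λ a↝i → Reach-trans σ (Reach-insertZero-suc (suc i) a↝i) (1 , insertZero-self τ (suc i)))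

    Reach-from-zero⇔ : Injective _≡_ _≡_ τ → ∀ b → Reach σ zero (suc b) ⇔ Reach τ i b
    Reach-from-zero⇔ inj b = mk⇔ forward backward
      where
      forward : Reach σ zero (suc b) → Reach τ i b
      forward (zero  , ())
      forward (suc t , eq) = Reach-trans τ (Reach-σ τ i) (proj₂ (traced t (τ i)) b (trans (sym (iter-suc σ t zero)) eq))
      backward : Reach τ i b → Reach σ zero (suc b)
      backward i↝b = Reach-trans σ (Reach-σ σ zero)
        (Reach-insertZero-suc (suc i) (Reach-trans τ (Reach-sym τ inj (Reach-σ τ i)) i↝b))

    inCycleᵇ-zero : Injective _≡_ _≡_ τ → ∀ b → inCycleᵇ σ zero (suc b) ≡ inCycleᵇ τ i b
    inCycleᵇ-zero inj b = inCycleᵇ-≡ (Reach-from-zero⇔ inj b)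

    isCycleRepᵇ-suc : ∀ a → isCycleRepᵇ σ (suc a) ≡ isCycleRepᵇ τ a ∧ not (inCycleᵇ τ a i)
    isCycleRepᵇ-suc a = ⇔→≡ (mk⇔
      (λ eq → let a-rep , a↛0 = to repr eq in
        ∧-intro a-rep (cong not (¬-not (λ a∋i → a↛0 (from (Reach-to-zero⇔ a) (to (inCycleᵇ-⇔ τ a i) a∋i))))))
      (λ eq → let a-rep , a∌i = ∧-≡-true eq in
        from repr (a-rep , λ a↝0 → contradiction (from (inCycleᵇ-⇔ τ a i) (to (Reach-to-zero⇔ a) a↝0)) (not-true⇒≢true a∌i))))
      where repr = isCycleRepᵇ-insertZero-suc (suc i) a (λ b → to (Reach-suc⇔ a b))

  inCycleᵇ-insertZero-suc : ∀ c a b → inCycleᵇ (insertZero τ c) (suc a) (suc b) ≡ inCycleᵇ τ a b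
  inCycleᵇ-insertZero-suc zero    a b = inCycleᵇ-≡ (Fixed.Reach-suc⇔ a b)
  inCycleᵇ-insertZero-suc (suc i) a b = inCycleᵇ-≡ (Inserted.Reach-suc⇔ i a b)

-- The recursion for Φ

module PermutationSums {c ℓ} (M : CommutativeMonoid c ℓ) where
  open CommutativeMonoid M renaming (Carrier to C; refl to ≈-refl; sym to ≈-sym; trans to ≈-trans)
  open BigOperators M hiding (sum-syntax)
  open import Relation.Binary.Reasoning.Setoid setoid

  sumPerms : ∀ m → ((Fin m → Fin m) → C) → C
  sumPerms m H = sumᴸ (allFuns m m) (λ σ → when (isInjectiveᵇ σ) (H σ))

  sumPerms-cong : ∀ m {H H′ : (Fin m → Fin m) → C} → (∀ σ → Injective _≡_ _≡_ σ → H σ ≈ H′ σ) → sumPerms m H ≈ sumPerms m H′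
  sumPerms-cong m {H} {H′} H≈H′ = sumᴸ-cong (allFuns m m) pointwise
    where
    pointwise : ∀ σ → when (isInjectiveᵇ σ) (H σ) ≈ when (isInjectiveᵇ σ) (H′ σ)
    pointwise σ with isInjectiveᵇ σ in σ-inj
    ... | true  = H≈H′ σ (to (isInjectiveᵇ-⇔ σ) σ-inj)
    ... | false = ≈-refl

  module _ {m} (H : (Fin (suc m) → Fin (suc m)) → C) (H-cong : ∀ {σ σ′} → σ ≗ σ′ → H σ ≈ H σ′) where

    private
      Perms₊ = allFuns (suc m) (suc m)
      Perms₀ = allFuns m m

      preimage : (Fin m → Fin m) → Fin (suc m) → (Fin (suc m) → Fin (suc m)) → Bool
      preimage τ c σ = isInjectiveᵇ τ ∧ insertZero τ c ≗ᵇ σ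

      spread : ∀ σ → when (isInjectiveᵇ σ) (H σ)
                     ≈ sumᴸ Perms₀ (λ τ → sum {suc m} (λ c → when (isInjectiveᵇ σ) ([ preimage τ c σ ] times H σ)))
      spread σ with isInjectiveᵇ σ in σ-inj
      ... | false = ≈-sym (sumᴸ-zero Perms₀ _ (λ τ → sum-zero (suc m) _ (λ _ → ≈-refl)))
      ... | true  = begin
        H σ                                                              ≈⟨ ×-homo-1 (H σ) ⟨
        1 times H σ                                                      ≡⟨ cong (_times H σ) (insertZero-fibre-count σ (to (isInjectiveᵇ-⇔ σ) σ-inj)) ⟨
        sumᴸℕ Perms₀ (λ τ → ∑[ c < suc m ] [ preimage τ c σ ]) times H σ ≈⟨ sumᴸ-× Perms₀ _ (H σ) ⟨
        sumᴸ Perms₀ (λ τ → (∑[ c < suc m ] [ preimage τ c σ ]) times H σ) ≈⟨ sumᴸ-cong Perms₀ (λ τ → sum-× (suc m) (λ c → [ preimage τ c σ ]) (H σ)) ⟨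
        sumᴸ Perms₀ (λ τ → sum {suc m} (λ c → [ preimage τ c σ ] times H σ)) ∎

      W : (Fin m → Fin m) → Fin (suc m) → (Fin (suc m) → Fin (suc m)) → C
      W τ c σ = when (isInjectiveᵇ σ) ([ preimage τ c σ ] times H σ)

      reweigh : ∀ τ c σ → when (isInjectiveᵇ σ) ([ insertZero τ c ≗ᵇ σ ] times H σ)
                          ≈ [ isInjectiveᵇ σ ∧ σ ≗ᵇ insertZero τ c ] times H (insertZero τ c)
      reweigh τ c σ rewrite ≗ᵇ-sym (insertZero τ c) σ with σ ≗ᵇ insertZero τ c in σ=τ↑ | isInjectiveᵇ σ
      ... | true  | true  = ∙-congʳ (H-cong (to (≗ᵇ-⇔ σ _) σ=τ↑))
      ... | true  | false = ≈-refl
      ... | false | true  = ≈-refl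
      ... | false | false = ≈-refl

      collect : ∀ τ c → sumᴸ Perms₊ (W τ c) ≈ when (isInjectiveᵇ τ) (H (insertZero τ c))
      collect τ c with isInjectiveᵇ τ in τ-inj
      ... | false = sumᴸ-zero Perms₊ _ (λ σ → when-ε (isInjectiveᵇ σ))
      ... | true  = begin
        sumᴸ Perms₊ (λ σ → when (isInjectiveᵇ σ) ([ τ↑ ≗ᵇ σ ] times H σ))    ≈⟨ sumᴸ-cong Perms₊ (reweigh τ c) ⟩
        sumᴸ Perms₊ (λ σ → [ isInjectiveᵇ σ ∧ σ ≗ᵇ τ↑ ] times H τ↑)           ≈⟨ sumᴸ-× Perms₊ _ (H τ↑) ⟩
        sumᴸℕ Perms₊ (λ σ → [ isInjectiveᵇ σ ∧ σ ≗ᵇ τ↑ ]) times H τ↑         ≡⟨ cong (_times H τ↑) (injective-count (suc m) τ↑) ⟩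
        [ isInjectiveᵇ τ↑ ] times H τ↑                                       ≡⟨ cong (λ b → [ b ] times H τ↑) τ↑-inj ⟩
        1 times H τ↑                                                         ≈⟨ ×-homo-1 (H τ↑) ⟩
        H τ↑                                                                 ∎
        where
        τ↑ = insertZero τ c
        τ↑-inj = from (isInjectiveᵇ-⇔ τ↑) (insertZero-injective (to (isInjectiveᵇ-⇔ τ) τ-inj) c)

    -- Double counting: every permutation of Fin (suc m) is `insertZero τ c` for exactly one (τ, c).
    sumPerms-suc : sumPerms (suc m) H ≈ sumPerms m (λ τ → sum {suc m} (λ c → H (insertZero τ c)))
    sumPerms-suc = begin
      sumᴸ Perms₊ (λ σ → when (isInjectiveᵇ σ) (H σ))                  ≈⟨ sumᴸ-cong Perms₊ spread ⟩
      sumᴸ Perms₊ (λ σ → sumᴸ Perms₀ (λ τ → sum (λ c → W τ c σ)))      ≈⟨ sumᴸ-comm Perms₊ Perms₀ _ ⟩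
      sumᴸ Perms₀ (λ τ → sumᴸ Perms₊ (λ σ → sum (λ c → W τ c σ)))      ≈⟨ sumᴸ-cong Perms₀ (λ τ → sumᴸ-comm-sum Perms₊ (suc m) (λ σ c → W τ c σ)) ⟩
      sumᴸ Perms₀ (λ τ → sum (λ c → sumᴸ Perms₊ (W τ c)))             ≈⟨ sumᴸ-cong Perms₀ (λ τ → sum-cong-≋ (collect τ)) ⟩
      sumᴸ Perms₀ (λ τ → sum (λ c → when (isInjectiveᵇ τ) (H (insertZero τ c)))) ≈⟨ sumᴸ-cong Perms₀ (λ τ → sum-when (suc m) (isInjectiveᵇ τ) (H ∘ insertZero τ)) ⟩
      sumᴸ Perms₀ (λ τ → when (isInjectiveᵇ τ) (sum (λ c → H (insertZero τ c)))) ∎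

module _ {c ℓ} (R : CommutativeRing c ℓ) where
  private
    module R = CommutativeRing R
    module ΣR = BigOperators R.+-commutativeMonoid
  open RingOps R using (negOnePow; nat)
  open import Algebra.Properties.Ring R.ring using (-‿involutive)
  open PermutationSums R.+-commutativeMonoid using (sumPerms)

  negOnePow-+-double : ∀ n k → negOnePow (n + (k + k)) R.≈ negOnePow n
  negOnePow-+-double n zero    = R.reflexive (cong negOnePow (ℕₚ.+-identityʳ n))
  negOnePow-+-double n (suc k) = R.trans (R.reflexive (cong negOnePow shift)) (R.trans (-‿involutive _) (negOnePow-+-double n k))
    where
    shift : n + (suc k + suc k) ≡ suc (suc (n + (k + k)))
    shift = trans (ℕₚ.+-suc n (k + suc k)) (cong suc (trans (cong (n +_) (ℕₚ.+-suc k k)) (ℕₚ.+-suc n (k + k))))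

  sum-constant : ∀ n x → ΣR.sum {n} (λ _ → x) R.≈ nat n R.* x
  sum-constant zero    x = R.sym (R.zeroˡ x)
  sum-constant (suc n) x = R.trans (R.+-cong (R.sym (R.*-identityˡ x)) (sum-constant n x)) (R.sym (R.distribʳ x R.1# (nat n)))

  sumPerms-*ˡ : ∀ m k (H : (Fin m → Fin m) → R.Carrier) → sumPerms m (λ σ → k R.* H σ) R.≈ k R.* sumPerms m H
  sumPerms-*ˡ m k H = sumᴸ-*ˡ (allFuns m m)
    where
    when-*ˡ : ∀ b x → ΣR.when b (k R.* x) R.≈ k R.* ΣR.when b x
    when-*ˡ true  x = R.refl
    when-*ˡ false x = R.sym (R.zeroʳ k)
    sumᴸ-*ˡ : ∀ L → ΣR.sumᴸ L (λ σ → ΣR.when (isInjectiveᵇ σ) (k R.* H σ)) R.≈ k R.* ΣR.sumᴸ L (λ σ → ΣR.when (isInjectiveᵇ σ) (H σ))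
    sumᴸ-*ˡ []      = R.sym (R.zeroʳ k)
    sumᴸ-*ˡ (σ ∷ L) = R.trans (R.+-cong (when-*ˡ (isInjectiveᵇ σ) (H σ)) (sumᴸ-*ˡ L)) (R.sym (R.distribˡ k _ _))

module PhiRecursion {c ℓ a ℓa b ℓb} {K : Field c ℓ} (A : CAlgebra K a ℓa) (B : CAlgebra K b ℓb)
                    (f : CAlgebra.Carrier A → CAlgebra.Carrier B)
                    (f-cong : ∀ {x y} → CAlgebra._≈_ A x y → CAlgebra._≈_ B (f x) (f y)) where

  private
    module A = CAlgebra A
    module B = CAlgebra B
    module ∏A = BigOperators A.*-commutativeMonoid
    module ∏B = BigOperators B.*-commutativeMonoid
    module ΣB = BigOperators B.+-commutativeMonoid
    open RingOps B.commRing using (negOnePow; nat)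
  open B using (_≈_; setoid)
  open PermutationSums B.+-commutativeMonoid using (sumPerms; sumPerms-cong; sumPerms-suc)
  open import Relation.Binary.Reasoning.Setoid setoid

  cycleProduct : ∀ {m} → (Fin m → Fin m) → Fin m → (Fin m → A.Carrier) → A.Carrier
  cycleProduct σ x as = ∏A.sum (λ y → ∏A.when (inCycleᵇ σ x y) (as y))

  cycleTerm : ∀ {m} → (Fin m → Fin m) → (Fin m → A.Carrier) → B.Carrier
  cycleTerm σ as = ∏B.sum (λ x → ∏B.when (isCycleRepᵇ σ x) (f (cycleProduct σ x as)))

  fPerm≈cycleTerm : ∀ {m} (σ : Fin m → Fin m) as → fPerm A B f σ as ≈ cycleTerm σ as
  fPerm≈cycleTerm {m} σ as = begin
    fPerm A B f σ as
      ≈⟨ ∏B.sumᴸ-filterᵇ (allFin m) (isCycleRepᵇ σ) (λ x → fCycle A B f σ x as) ⟩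
    ∏B.sumᴸ (allFin m) (λ x → ∏B.when (isCycleRepᵇ σ x) (fCycle A B f σ x as))
      ≡⟨ ∏B.sumᴸ-allFin m _ ⟩
    ∏B.sum (λ x → ∏B.when (isCycleRepᵇ σ x) (fCycle A B f σ x as))
      ≈⟨ ∏B.sum-cong-≋ (λ x → ∏B.when-cong (isCycleRepᵇ σ x) (f-cong (cycle x))) ⟩
    cycleTerm σ as ∎
    where
    cycle : ∀ x → RingOps.prodL A.commRing (map as (filterᵇ (inCycleᵇ σ x) (allFin m))) A.≈ cycleProduct σ x as
    cycle x = A.trans (∏A.sumᴸ-filterᵇ (allFin m) (inCycleᵇ σ x) as) (A.reflexive (∏A.sumᴸ-allFin m _))

  cycleTerm-cong : ∀ {m} {σ σ′ : Fin m → Fin m} → σ ≗ σ′ → ∀ as → cycleTerm σ as ≈ cycleTerm σ′ as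
  cycleTerm-cong σ≗σ′ as = ∏B.sum-cong-≋ (λ x → B.reflexive (cong₂ ∏B.when (isCycleRepᵇ-cong σ≗σ′ x)
    (cong f (∏A.sum-cong-≗ (λ y → cong (λ b → ∏A.when b (as y)) (inCycleᵇ-cong σ≗σ′ x y))))))

  sign : ∀ {m} → (Fin m → Fin m) → B.Carrier
  sign σ = negOnePow (inversions σ)

  signedTerm : ∀ {m} → (Fin m → A.Carrier) → (Fin m → Fin m) → B.Carrier
  signedTerm as σ = sign σ B.* fPerm A B f σ as

  signedTerm-cong : ∀ {m} (as : Fin m → A.Carrier) {σ σ′ : Fin m → Fin m} → σ ≗ σ′ → signedTerm as σ ≈ signedTerm as σ′
  signedTerm-cong as {σ} {σ′} σ≗σ′ = B.*-cong (B.reflexive (cong negOnePow (inversions-cong σ≗σ′)))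
    (B.trans (fPerm≈cycleTerm σ as) (B.trans (cycleTerm-cong σ≗σ′ as) (B.sym (fPerm≈cycleTerm σ′ as))))

  Φ≈sumPerms : ∀ m as → Φ A B m f as ≈ sumPerms m (signedTerm as)
  Φ≈sumPerms m as = ΣB.sumᴸ-filterᵇ (allFuns m m) isInjectiveᵇ (signedTerm as)

  sign-fixed : ∀ {m} (τ : Fin m → Fin m) → sign (insertZero τ zero) ≡ sign τ
  sign-fixed τ = cong negOnePow (inversions-insertZero-fixed τ)

  sign-inserted : ∀ {m} (τ : Fin m → Fin m) → Injective _≡_ _≡_ τ → ∀ i → sign (insertZero τ (suc i)) ≈ B.- sign τ
  sign-inserted τ inj i with k , parity ← inversionCount-insertZero-suc τ i inj = begin
    negOnePow (inversions σ)                                  ≡⟨ cong negOnePow (inversions≡inversionCount σ) ⟩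
    negOnePow (inversionCount σ)                              ≈⟨ negOnePow-+-double B.commRing (inversionCount σ) k ⟨
    negOnePow (inversionCount σ + (k + k))                    ≡⟨ cong negOnePow parity ⟩
    B.- negOnePow (inversionCount τ + (toℕ i + toℕ i))        ≈⟨ B.-‿cong (negOnePow-+-double B.commRing (inversionCount τ) (toℕ i)) ⟩
    B.- negOnePow (inversionCount τ)                          ≡⟨ cong (λ n → B.- negOnePow n) (inversions≡inversionCount τ) ⟨
    B.- sign τ                                                ∎
    where σ = insertZero τ (suc i)

  module _ {m} (τ : Fin m → Fin m) (bs : Fin m → A.Carrier) where

    private
      as = A.1# ∷ᶠ bs
      open import Algebra.Properties.Ring B.ring using (-‿distribˡ-*; -‿distribʳ-*)
      open import Algebra.Properties.CommutativeSemigroup B.*-commutativeSemigroup using (x∙yz≈y∙xz)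

    cycleProduct-one : ∀ c x → cycleProduct (insertZero τ c) x as A.≈ ∏A.sum (λ y → ∏A.when (inCycleᵇ (insertZero τ c) x (suc y)) (bs y))
    cycleProduct-one c x = A.trans (A.*-congʳ (∏A.when-ε (inCycleᵇ (insertZero τ c) x zero))) (A.*-identityˡ _)

    cycleProduct-suc : ∀ c x → cycleProduct (insertZero τ c) (suc x) as A.≈ cycleProduct τ x bs
    cycleProduct-suc c x = A.trans (cycleProduct-one c (suc x))
      (∏A.sum-cong-≋ (λ y → A.reflexive (cong (λ b → ∏A.when b (bs y)) (inCycleᵇ-insertZero-suc τ c x y))))

    cycleFactor-suc : ∀ c x → ∏B.when (isCycleRepᵇ (insertZero τ c) (suc x)) (f (cycleProduct (insertZero τ c) (suc x) as))
                              ≈ ∏B.when (isCycleRepᵇ (insertZero τ c) (suc x)) (f (cycleProduct τ x bs))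
    cycleFactor-suc c x = ∏B.when-cong (isCycleRepᵇ (insertZero τ c) (suc x)) (f-cong (cycleProduct-suc c x))

    cycleTerm-fixed : cycleTerm (insertZero τ zero) as ≈ f A.1# B.* cycleTerm τ bs
    cycleTerm-fixed = B.*-cong zeroCycle (∏B.sum-cong-≋ λ x →
      B.trans (cycleFactor-suc zero x) (B.reflexive (cong (λ b → ∏B.when b (f (cycleProduct τ x bs))) (Fixed.isCycleRepᵇ-suc τ x))))
      where
      zeroCycle : ∏B.when (isCycleRepᵇ (insertZero τ zero) zero) (f (cycleProduct (insertZero τ zero) zero as)) ≈ f A.1#
      zeroCycle rewrite isCycleRepᵇ-insertZero-zero τ zero = f-cong (A.trans (cycleProduct-one zero zero)
        (∏A.sum-zero m _ (λ y → A.reflexive (cong (λ b → ∏A.when b (bs y)) (Fixed.inCycleᵇ-zero τ y)))))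

    -- The cycle of σ through 0 is the cycle of τ through i with 0 inserted, and a₀ = 1.
    cycleTerm-inserted : Injective _≡_ _≡_ τ → ∀ i → cycleTerm (insertZero τ (suc i)) as ≈ cycleTerm τ bs
    cycleTerm-inserted inj i = begin
      cycleTerm (insertZero τ (suc i)) as
        ≈⟨ B.*-cong zeroCycle (∏B.sum-cong-≋ λ x → B.trans (cycleFactor-suc (suc i) x)
             (B.reflexive (cong (λ b → ∏B.when b (F x)) (Inserted.isCycleRepᵇ-suc τ i x)))) ⟩
      F rep B.* ∏B.sum (λ x → ∏B.when (away x) (F x))
        ≈⟨ B.*-congʳ (∏B.sum-when-unique m through F rep
             (∧-intro rep-isCycleRep (from (inCycleᵇ-⇔ τ rep i) rep↝i)) rep-unique) ⟨
      ∏B.sum (λ x → ∏B.when (through x) (F x)) B.* ∏B.sum (λ x → ∏B.when (away x) (F x))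
        ≈⟨ ∏B.∑-distrib-+ (λ x → ∏B.when (through x) (F x)) (λ x → ∏B.when (away x) (F x)) ⟨
      ∏B.sum (λ x → ∏B.when (through x) (F x) B.* ∏B.when (away x) (F x))
        ≈⟨ ∏B.sum-cong-≋ (λ x → ∏B.when-split (isCycleRepᵇ τ x) (inCycleᵇ τ x i) (F x)) ⟨
      cycleTerm τ bs ∎
      where
      open CycleRepresentative τ inj i
      F : Fin m → B.Carrier
      F x = f (cycleProduct τ x bs)
      through away : Fin m → Bool
      through x = isCycleRepᵇ τ x ∧ inCycleᵇ τ x i
      away    x = isCycleRepᵇ τ x ∧ not (inCycleᵇ τ x i)
      zeroCycle : ∏B.when (isCycleRepᵇ (insertZero τ (suc i)) zero) (f (cycleProduct (insertZero τ (suc i)) zero as)) ≈ F rep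
      zeroCycle rewrite isCycleRepᵇ-insertZero-zero τ (suc i) = f-cong (A.trans (cycleProduct-one (suc i) zero)
        (∏A.sum-cong-≋ (λ y → A.reflexive (cong (λ b → ∏A.when b (bs y)) (trans (Inserted.inCycleᵇ-zero τ i inj y) (sym (rep-inCycle y)))))))

    signedTerm-fixed : signedTerm as (insertZero τ zero) ≈ f A.1# B.* signedTerm bs τ
    signedTerm-fixed = begin
      sign τ′ B.* fPerm A B f τ′ as                ≈⟨ B.*-cong (B.reflexive (sign-fixed τ)) (fPerm≈cycleTerm τ′ as) ⟩
      sign τ B.* cycleTerm τ′ as                   ≈⟨ B.*-congˡ (cycleTerm-fixed) ⟩
      sign τ B.* (f A.1# B.* cycleTerm τ bs)       ≈⟨ B.*-congˡ (B.*-congˡ (fPerm≈cycleTerm τ bs)) ⟨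
      sign τ B.* (f A.1# B.* fPerm A B f τ bs)     ≈⟨ x∙yz≈y∙xz (sign τ) (f A.1#) _ ⟩
      f A.1# B.* signedTerm bs τ                   ∎
      where τ′ = insertZero τ zero

    signedTerm-inserted : Injective _≡_ _≡_ τ → ∀ i → signedTerm as (insertZero τ (suc i)) ≈ B.- signedTerm bs τ
    signedTerm-inserted inj i = begin
      sign τ′ B.* fPerm A B f τ′ as                ≈⟨ B.*-cong (sign-inserted τ inj i) (fPerm≈cycleTerm τ′ as) ⟩
      B.- sign τ B.* cycleTerm τ′ as               ≈⟨ B.*-congˡ (cycleTerm-inserted inj i) ⟩
      B.- sign τ B.* cycleTerm τ bs                ≈⟨ B.*-congˡ (fPerm≈cycleTerm τ bs) ⟨
      B.- sign τ B.* fPerm A B f τ bs              ≈⟨ -‿distribˡ-* (sign τ) _ ⟨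
      B.- signedTerm bs τ                          ∎
      where τ′ = insertZero τ (suc i)

    sum-insertZero : Injective _≡_ _≡_ τ → ΣB.sum (λ c → signedTerm as (insertZero τ c)) ≈ (f A.1# B.- nat m) B.* signedTerm bs τ
    sum-insertZero inj = begin
      signedTerm as (insertZero τ zero) B.+ ΣB.sum (λ i → signedTerm as (insertZero τ (suc i)))
        ≈⟨ B.+-cong signedTerm-fixed (ΣB.sum-cong-≋ (signedTerm-inserted inj)) ⟩
      f A.1# B.* G B.+ ΣB.sum {m} (λ _ → B.- G)
        ≈⟨ B.+-congˡ (sum-constant B.commRing m (B.- G)) ⟩
      f A.1# B.* G B.+ nat m B.* (B.- G)
        ≈⟨ B.+-congˡ (-‿distribʳ-* (nat m) G) ⟨
      f A.1# B.* G B.+ B.- (nat m B.* G)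
        ≈⟨ B.+-congˡ (-‿distribˡ-* (nat m) G) ⟩
      f A.1# B.* G B.+ (B.- nat m) B.* G
        ≈⟨ B.distribʳ G (f A.1#) (B.- nat m) ⟨
      (f A.1# B.- nat m) B.* G ∎
      where G = signedTerm bs τ

  Φ-one : ∀ m bs → Φ A B (suc m) f (A.1# ∷ᶠ bs) ≈ (f A.1# B.- nat m) B.* Φ A B m f bs
  Φ-one m bs = begin
    Φ A B (suc m) f as                                                 ≈⟨ Φ≈sumPerms (suc m) as ⟩
    sumPerms (suc m) (signedTerm as)                                   ≈⟨ sumPerms-suc (signedTerm as) (signedTerm-cong as) ⟩
    sumPerms m (λ τ → ΣB.sum (λ c → signedTerm as (insertZero τ c)))  ≈⟨ sumPerms-cong m (λ τ inj → sum-insertZero τ bs inj) ⟩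
    sumPerms m (λ τ → κ B.* signedTerm bs τ)                           ≈⟨ sumPerms-*ˡ B.commRing m κ (signedTerm bs) ⟩
    κ B.* sumPerms m (signedTerm bs)                                   ≈⟨ B.*-congˡ (Φ≈sumPerms m bs) ⟨
    κ B.* Φ A B m f bs                                                 ∎
    where
    as = A.1# ∷ᶠ bs
    κ = f A.1# B.- nat m

module Descent {c ℓ a ℓa b ℓb} {K : Field c ℓ} (char0 : CharZero K)
               (A : CAlgebra K a ℓa) (B : CAlgebra K b ℓb)
               (f : CAlgebra.Carrier A → CAlgebra.Carrier B)
               (f-cong : ∀ {x y} → CAlgebra._≈_ A x y → CAlgebra._≈_ B (f x) (f y))
               (k : ℕ) (f1≈k : CAlgebra._≈_ B (f (CAlgebra.1# A)) (RingOps.nat (CAlgebra.commRing B) k)) where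

  private
    module K = Field K
    module A = CAlgebra A
    module B = CAlgebra B
    open RingOps B.commRing using (nat)
    open import Algebra.Properties.Ring B.ring using (x+x≈x⇒x≈0; -‿anti-homo-+; -‿distribˡ-*; -‿injective; -0#≈0#)
  open B using (_≈_; setoid)
  open import Relation.Binary.Reasoning.Setoid setoid

  ι-nat : ∀ n → B.ι (RingOps.nat K.commRing n) ≈ nat n
  ι-nat zero    = x+x≈x⇒x≈0 _ (B.trans (B.sym (B.ι-+ K.0# K.0#)) (B.ι-cong (K.+-identityˡ K.0#)))
  ι-nat (suc n) = B.trans (B.ι-+ K.1# _) (B.+-cong B.ι-1 (ι-nat n))

  nat-+ : ∀ m n → nat (m + n) ≈ nat m B.+ nat n
  nat-+ zero    n = B.sym (B.+-identityˡ _)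
  nat-+ (suc m) n = B.trans (B.+-congˡ (nat-+ m n)) (B.sym (B.+-assoc _ _ _))

  nat-suc-cancel : ∀ j {x} → nat (suc j) B.* x ≈ B.0# → x ≈ B.0#
  nat-suc-cancel j {x} Nx≈0 with y , Ny≈1 ← K.inverse (RingOps.nat K.commRing (suc j)) (char0 j) = begin
    x                               ≈⟨ B.*-identityˡ x ⟨
    B.1# B.* x                      ≈⟨ B.*-congʳ inverse ⟨
    (B.ι y B.* nat (suc j)) B.* x   ≈⟨ B.*-assoc _ _ x ⟩
    B.ι y B.* (nat (suc j) B.* x)   ≈⟨ B.*-congˡ Nx≈0 ⟩
    B.ι y B.* B.0#                  ≈⟨ B.zeroʳ _ ⟩
    B.0#                            ∎
    where
    inverse : B.ι y B.* nat (suc j) ≈ B.1#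
    inverse = B.trans (B.*-congˡ (B.sym (ι-nat (suc j))))
             (B.trans (B.sym (B.ι-* y _)) (B.trans (B.ι-cong (K.trans (K.*-comm y _) Ny≈1)) B.ι-1))

  coefficient : ∀ d → f A.1# B.- nat (d + k) ≈ B.- nat d
  coefficient d = begin
    f A.1# B.- nat (d + k)                ≈⟨ B.+-cong f1≈k (B.-‿cong (nat-+ d k)) ⟩
    nat k B.+ B.- (nat d B.+ nat k)       ≈⟨ B.+-congˡ (-‿anti-homo-+ (nat d) (nat k)) ⟩
    nat k B.+ (B.- nat k B.+ B.- nat d)   ≈⟨ B.+-assoc _ _ _ ⟨
    (nat k B.+ B.- nat k) B.+ B.- nat d   ≈⟨ B.+-congʳ (B.-‿inverseʳ (nat k)) ⟩
    B.0# B.+ B.- nat d                    ≈⟨ B.+-identityˡ _ ⟩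
    B.- nat d                             ∎

  ΦVanishes-step : ∀ j → ΦVanishes A B (suc (suc j + k)) f → ΦVanishes A B (suc j + k) f
  ΦVanishes-step j Φ≈0 bs = nat-suc-cancel j (-‿injective (begin
    B.- (nat (suc j) B.* X)               ≈⟨ -‿distribˡ-* (nat (suc j)) X ⟩
    B.- nat (suc j) B.* X                 ≈⟨ B.*-congʳ (coefficient (suc j)) ⟨
    (f A.1# B.- nat (suc j + k)) B.* X    ≈⟨ PhiRecursion.Φ-one A B f f-cong (suc j + k) bs ⟨
    Φ A B _ f (A.1# ∷ᶠ bs)                ≈⟨ Φ≈0 (A.1# ∷ᶠ bs) ⟩
    B.0#                                  ≈⟨ -0#≈0# ⟨
    B.- B.0#                              ∎))
    where X = Φ A B (suc j + k) f bs

  ΦVanishes-descend : ∀ d → ΦVanishes A B (suc (d + k)) f → ΦVanishes A B (suc k) f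
  ΦVanishes-descend zero    Φ≈0 = Φ≈0
  ΦVanishes-descend (suc d) Φ≈0 = ΦVanishes-descend d (ΦVanishes-step d Φ≈0)

proposition2p7 : ∀ {c ℓ a ℓa b ℓb} (K : Field c ℓ) → CharZero K →
    (A : CAlgebra K a ℓa) (B : CAlgebra K b ℓb) → IsIntegralDomain B →
    (f : CAlgebra.Carrier A → CAlgebra.Carrier B) → IsLinear A B f →
    (n k : ℕ) → k ≤ n →
    ΦVanishes A B (suc n) f →
    CAlgebra._≈_ B (f (CAlgebra.1# A)) (RingOps.nat (CAlgebra.commRing B) k) →
    IsFrobeniusHom A B k f
proposition2p7 K char0 A B _ f linear n k k≤n Φₙ₊₁≈0 f1≈k =
  ΦVanishes-descend (n ∸ k) (subst (λ m → ΦVanishes A B (suc m) f) (sym (ℕₚ.m∸n+n≡m k≤n)) Φₙ₊₁≈0) , f1≈k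
  where open Descent char0 A B f (IsLinear.cong linear) k f1≈k
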